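{- Let $w\in S_\infty$. Then \[ \sum_{(k,v):\ w\doteq s_kv}F_v(x)=\sum_{(k,u):\ w\doteq us_k}F_u(x). \]
   Context: $S_\infty$ = permutations of $\mathbb{N}$ with finite support, $s_k=(k\ k+1)$, $\ell$ = length; $x\doteq yz$ means $x=yz$ and $\ell(x)=\ell(y)+\ell(z)$; $k$ ranges over $\mathbb{N}$. Demazure product: $s_i*w=s_iw$ if $\ell(s_iw)>\ell(w)$, else $w$. Positions $(i,j)$, $i$ = row (downward), $j$ = column (rightward). A stable pipe dream is a finite subset $P\subseteq\{(i,j)\in\mathbb{N}\times\mathbb{Z}: i+j-1\ge1\}$; its permutation is $\partial(P)=s_{a_1}*\cdots*s_{a_r}$ where $(a_1,\dots,a_r)$ lists the values $i+j-1$ for $(i,j)\in P$, reading each row right to left and rows top to bottom; it is reduced if $|P|=\ell(\partial(P))$. The Stanley symmetric function is $F_w(x)=\sum_P\prod_{(i,j)\in P}x_i$ over reduced stable pipe dreams $P$ with $\partial(P)=w$. -}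

module Defs where

open import Data.Bool using (Bool; true; false; _∧_; if_then_else_; T)
open import Data.Nat using (ℕ; zero; suc; _+_; _≤_; _<_; _≡ᵇ_; _<ᵇ_; _≤ᵇ_; _⊔_; z≤n; s≤s)
open import Data.Nat.Properties using (≡ᵇ⇒≡; ≡⇒≡ᵇ; ≤-trans; m≤m⊔n; m≤n⊔m; <⇒≢; ≤-refl; n<1+n; <-trans)
open import Data.Integer as ℤ using (ℤ; +_)
open import Data.List using (List; []; _∷_; map; length; upTo)
open import Data.Nat.ListAction using (sum)
open import Data.Bool.ListAction using (all)
open import Data.Sum using (_⊎_; inj₁; inj₂)
open import Data.Product using (Σ; _×_; _,_)
open import Relation.Binary.PropositionalEquality
open import Relation.Nullary using (¬_; yes; no)
import Data.Nat
open import Data.Empty using (⊥-elim)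

-- Permutations of ℕ = {1,2,3,...} with finite support.
-- Agda's ℕ contains 0; by convention a permutation fixes 0 (so it
-- restricts to a finitely supported permutation of {1,2,...}).

record Perm : Set where
  field
    fun     : ℕ → ℕ
    inv     : ℕ → ℕ
    fun-inv : ∀ n → fun (inv n) ≡ n
    inv-fun : ∀ n → inv (fun n) ≡ n
    bound   : ℕ
    fix0    : fun 0 ≡ 0
    fixed   : ∀ n → bound < n → fun n ≡ n
open Perm public

idP : Perm
idP = record { fun = λ n → n ; inv = λ n → n ; fun-inv = λ _ → refl
             ; inv-fun = λ _ → refl ; bound = 0 ; fix0 = refl ; fixed = λ _ _ → refl }

_·_ : Perm → Perm → Perm
v · w = record
  { fun = λ n → fun v (fun w n)
  ; inv = λ n → inv w (inv v n)
  ; fun-inv = λ n → trans (cong (fun v) (fun-inv w (inv v n))) (fun-inv v n)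
  ; inv-fun = λ n → trans (cong (inv w) (inv-fun v (fun w n))) (inv-fun w n)
  ; bound = bound v ⊔ bound w
  ; fix0 = trans (cong (fun v) (fix0 w)) (fix0 v)
  ; fixed = λ n lt → trans (cong (fun v) (fixed w n (≤-trans (s≤s (m≤n⊔m (bound v) (bound w))) lt)))
                           (fixed v n (≤-trans (s≤s (m≤m⊔n (bound v) (bound w))) lt))
  }

tr : ℕ → ℕ → ℕ
tr a n = if n ≡ᵇ a then suc a else (if n ≡ᵇ suc a then a else n)

private
  eqb-refl : ∀ m → (m ≡ᵇ m) ≡ true
  eqb-refl zero = refl
  eqb-refl (suc m) = eqb-refl m

  eqb-false : ∀ m n → ¬ m ≡ n → (m ≡ᵇ n) ≡ false
  eqb-false zero zero ne = ⊥-elim (ne refl)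
  eqb-false zero (suc n) ne = refl
  eqb-false (suc m) zero ne = refl
  eqb-false (suc m) (suc n) ne = eqb-false m n (λ e → ne (cong suc e))

  sa≢a : ∀ a → ¬ suc a ≡ a
  sa≢a zero ()
  sa≢a (suc a) e = sa≢a a (cong Data.Nat.pred e)

  tr-a : ∀ a → tr a a ≡ suc a
  tr-a a rewrite eqb-refl a = refl

  tr-sa : ∀ a → tr a (suc a) ≡ a
  tr-sa a rewrite eqb-false (suc a) a (sa≢a a) | eqb-refl (suc a) = refl

  tr-other : ∀ a n → ¬ n ≡ a → ¬ n ≡ suc a → tr a n ≡ n
  tr-other a n p q rewrite eqb-false n a p | eqb-false n (suc a) q = refl

  tr-invol : ∀ a n → tr a (tr a n) ≡ n
  tr-invol a n with n Data.Nat.≟ a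
  ... | yes refl = trans (cong (tr a) (tr-a a)) (tr-sa a)
  ... | no p with n Data.Nat.≟ suc a
  ...   | yes refl = trans (cong (tr a) (tr-sa a)) (tr-a a)
  ...   | no q = trans (cong (tr a) (tr-other a n p q)) (tr-other a n p q)

-- s k = (k k+1) for k ≥ 1.  (s 0 is a junk value, the identity; it is
-- never used: the statement only involves s k with k ≥ 1.)
s : ℕ → Perm
s zero = idP
s (suc a) = record
  { fun = tr (suc a) ; inv = tr (suc a)
  ; fun-inv = tr-invol (suc a) ; inv-fun = tr-invol (suc a)
  ; bound = suc (suc a) ; fix0 = refl
  ; fixed = λ n lt → fx n lt }
  where
  fx : ∀ n → suc (suc a) < n → tr (suc a) n ≡ n
  fx n lt = tr-other (suc a) n (λ e → <⇒≢ (<-trans (n<1+n (suc a)) lt) (sym e))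
                               (λ e → <⇒≢ lt (sym e))

range : ℕ → ℕ → List ℕ
range lo hi = Data.List.filter (λ n → lo Data.Nat.≤? n) (upTo (suc hi))

-- ℓ(w) = number of inversions: pairs 1 ≤ i < j with w(i) > w(j)
-- (all inversions lie inside {1,...,bound w})
ℓ : Perm → ℕ
ℓ w = sum (map (λ j → sum (map (λ i → if fun w j <ᵇ fun w i then 1 else 0)
                               (range 1 (Data.Nat.pred j))))
               (range 1 (bound w)))

_==ᴾ_ : Perm → Perm → Bool
v ==ᴾ w = all (λ n → fun v n ≡ᵇ fun w n) (upTo (suc (bound v ⊔ bound w)))

_*_ : ℕ → Perm → Perm
i * w = if ℓ w <ᵇ ℓ (s i · w) then s i · w else w

-- A finite subset P ⊆ {(i,j) ∈ ℕ × ℤ : i + j - 1 ≥ 1} is represented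
-- canonically by the list of its rows (row 1 first); row i is the list of
-- the columns j with (i,j) ∈ P in strictly decreasing order (i.e. read
-- right to left).  Rows below the last listed row are empty.

strictDec : List ℤ → Bool
strictDec [] = true
strictDec (x ∷ []) = true
strictDec (x ∷ y ∷ ys) = (y <ᵇ' x) ∧ strictDec (y ∷ ys)
  where
  _<ᵇ'_ : ℤ → ℤ → Bool
  a <ᵇ' b = ℤ.suc a ℤ.≤ᵇ b

val : ℕ → ℤ → ℤ
val i j = (+ i) ℤ.+ j ℤ.- ℤ.1ℤ

rowOK : ℕ → List ℤ → Bool
rowOK i r = strictDec r ∧ all (λ j → ℤ.1ℤ ℤ.≤ᵇ val i j) r

rowsOK : ℕ → List (List ℤ) → Bool
rowsOK i [] = true
rowsOK i (r ∷ rs) = rowOK i r ∧ rowsOK (suc i) rs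

-- the row counts of P are exactly α (α = exponent vector of the monomial
-- x₁^α₁ x₂^α₂ ⋯ ; entries beyond the end of α are 0)
rowCounts : List (List ℤ) → List ℕ
rowCounts = map length

_==ᴸ_ : List ℕ → List ℕ → Bool
[] ==ᴸ [] = true
(a ∷ as) ==ᴸ (b ∷ bs) = (a ≡ᵇ b) ∧ (as ==ᴸ bs)
_ ==ᴸ _ = false

isSPD : List ℕ → List (List ℤ) → Bool
isSPD α P = rowsOK 1 P ∧ (rowCounts P ==ᴸ α)

wordFrom : ℕ → List (List ℤ) → List ℕ
wordFrom i [] = []
wordFrom i (r ∷ rs) = map (λ j → ℤ.∣ val i j ∣) r Data.List.++ wordFrom (suc i) rs

word : List (List ℤ) → List ℕ
word = wordFrom 1

-- ∂(P) = s_{a₁} * ⋯ * s_{a_r}  (Demazure product, associative; computed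
-- as s_{a₁} * (s_{a₂} * ( ⋯ * (s_{a_r} * id))))
∂ : List (List ℤ) → Perm
∂ P = Data.List.foldr _*_ idP (word P)

isReduced : List (List ℤ) → Bool
isReduced P = length (word P) ≡ᵇ ℓ (∂ P)

-- The terms of F_v with monomial x^α: reduced stable pipe dreams P with
-- ∂(P) = v and weight x^α.  So the coefficient of x^α in F_v is the
-- cardinality of this (finite) type.
FTerms : Perm → List ℕ → Set
FTerms v α = Σ (List (List ℤ)) λ P → T (isSPD α P ∧ isReduced P ∧ (∂ P ==ᴾ v))

-- Terms of x^α in  Σ_{(k,v) : w ≐ s_k v} F_v .  Given k, v = s_k w is
-- forced, and w ≐ s_k v  iff  ℓ(w) = ℓ(s_k w) + 1.
LeftTerms : Perm → List ℕ → Set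
LeftTerms w α = Σ ℕ λ k → T ((1 ≤ᵇ k) ∧ (ℓ (s k · w) + 1 ≡ᵇ ℓ w)) × FTerms (s k · w) α

-- Terms of x^α in  Σ_{(k,u) : w ≐ u s_k} F_u ;  u = w s_k is forced.
RightTerms : Perm → List ℕ → Set
RightTerms w α = Σ ℕ λ k → T ((1 ≤ᵇ k) ∧ (ℓ (w · s k) + 1 ≡ᵇ ℓ w)) × FTerms (w · s k) α

-- Reading the rows of a reduced stable pipe dream (each right to left) gives a reduced word of its
-- permutation cut into strictly decreasing rows of positive letters, the row lengths recording the
-- monomial, and every such factorization comes from exactly one pipe dream.  If w ≐ s_k v and the rows
-- factor a reduced word of v, the word k · rows is reduced for w.  Push the letter k to the right
-- through the rows, one row at a time, using only commutations and braid relations; each row stays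
-- strictly decreasing of the same length, and a letter k′ leaves on the right, so w ≐ u s_{k′} with u
-- factored by the new rows.  Reducedness excludes the only obstruction (the letter meeting its own
-- copy), and every row step can be undone by pushing k′ back to the left, so this is a bijection
-- between the terms of the two sums that preserves the monomial.
module Submission where

open import Defs renaming (_*_ to _⋆_)
open import Data.Bool using (Bool; true; false; _∧_; if_then_else_; T)
open import Data.Bool.Properties using (T-∧; T-≡; T-irrelevant)
open import Data.Empty using (⊥; ⊥-elim)
open import Data.Integer as ℤ using (ℤ; 1ℤ; ∣_∣)
import Data.Integer.Properties as ℤP
open import Data.Integer.Tactic.RingSolver using (solve-∀)
open import Data.List using (List; []; _∷_; _++_; _∷ʳ_; map; length; concat; foldr; applyUpTo; upTo)
open import Data.List.Properties
  using (length-++; length-++-sucʳ; length-map; ++-assoc; ++-identityʳ; ∷-injectiveˡ; ∷-injectiveʳ;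
         map-++; map-∘; map-id-local; applyUpTo-∷ʳ; filter-all)
open import Data.List.Relation.Unary.All as All using (All; []; _∷_)
import Data.List.Relation.Unary.All.Properties as All
open import Data.List.Relation.Unary.All.Properties using (all⁺; all⁻; applyUpTo⁺₂; applyUpTo⁻)
open import Data.List.Relation.Unary.AllPairs using (AllPairs; []; _∷_)
open import Data.List.Relation.Unary.Linked as Linked using (Linked; []; [-]; _∷_)
import Data.List.Relation.Unary.Linked.Properties as Linked
open import Data.List.Relation.Unary.Linked.Properties using (Linked⇒AllPairs; AllPairs⇒Linked)
open import Data.Maybe as Maybe using (Maybe; just; nothing)
open import Data.Maybe.Properties using (just-injective)
open import Data.Nat
open import Data.Nat.ListAction using (sum)
open import Data.Nat.ListAction.Properties using (sum-++)
open import Data.Nat.Properties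
open import Data.Product using (Σ; _×_; _,_; proj₁; proj₂)
open import Data.Sum using (_⊎_; inj₁; inj₂)
open import Data.Unit using (⊤; tt)
open import Function using (_∘_; id; Equivalence; Injective; _↔_; mk↔ₛ′)
open import Relation.Binary.Bundles using (Setoid)
open import Relation.Binary.PropositionalEquality
import Relation.Binary.Reasoning.Setoid as SetoidReasoning
open import Relation.Binary.Structures using (IsEquivalence)
open import Relation.Nullary using (¬_; Dec; yes; no; contradiction)

open import Algebra.Properties.CommutativeSemigroup +-commutativeSemigroup using (interchange)

≢⇒≡ᵇ≡false : ∀ {m n} → m ≢ n → (m ≡ᵇ n) ≡ false
≢⇒≡ᵇ≡false {m} {n} m≢n with m ≡ᵇ n in eq
... | true  = contradiction (≡ᵇ⇒≡ m n (subst T (sym eq) tt)) m≢n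
... | false = refl

tr-at : ∀ a → tr a a ≡ suc a
tr-at a rewrite Equivalence.to T-≡ (≡⇒≡ᵇ a a refl) = refl

tr-next : ∀ a → tr a (suc a) ≡ a
tr-next a rewrite ≢⇒≡ᵇ≡false (1+n≢n {a}) | Equivalence.to T-≡ (≡⇒≡ᵇ (suc a) (suc a) refl) = refl

tr-away : ∀ {a n} → n ≢ a → n ≢ suc a → tr a n ≡ n
tr-away n≢a n≢1+a rewrite ≢⇒≡ᵇ≡false n≢a | ≢⇒≡ᵇ≡false n≢1+a = refl

data TrView (a n : ℕ) : Set where
  at   : n ≡ a → TrView a n
  next : n ≡ suc a → TrView a n
  away : n ≢ a → n ≢ suc a → TrView a n

trView : ∀ a n → TrView a n
trView a n with n ≟ a | n ≟ suc a
... | yes n≡a | _         = at n≡a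
... | no _    | yes n≡1+a = next n≡1+a
... | no n≢a  | no n≢1+a  = away n≢a n≢1+a

tr-involutive : ∀ a n → tr a (tr a n) ≡ n
tr-involutive a n with trView a n
... | at refl       = trans (cong (tr a) (tr-at a)) (tr-next a)
... | next refl     = trans (cong (tr a) (tr-next a)) (tr-at a)
... | away n≢a n≢1+a = trans (cong (tr a) (tr-away n≢a n≢1+a)) (tr-away n≢a n≢1+a)

tr-reflects-< : ∀ a x y → tr a x < tr a y → x < y ⊎ (x ≡ suc a × y ≡ a)
tr-reflects-< a x y lt with trView a x | trView a y
... | at refl | at refl = ⊥-elim (<-irrefl refl lt)
... | at refl | next refl = ⊥-elim (<-asym (subst₂ _<_ (tr-at a) (tr-next a) lt) (n<1+n a))
... | at refl | away p q = inj₁ (<-trans (n<1+n a) (subst₂ _<_ (tr-at a) (tr-away p q) lt))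
... | next refl | at refl = inj₂ (refl , refl)
... | next refl | next refl = ⊥-elim (<-irrefl refl lt)
... | next refl | away p q = inj₁ (≤∧≢⇒< (subst₂ _<_ (tr-next a) (tr-away p q) lt) (q ∘ sym))
... | away p q | at refl = inj₁ (≤∧≢⇒< (≤-pred (subst₂ _<_ (tr-away p q) (tr-at a) lt)) p)
... | away p q | next refl = inj₁ (≤-trans (subst₂ _<_ (tr-away p q) (tr-next a) lt) (n≤1+n a))
... | away p q | away p′ q′ = inj₁ (subst₂ _<_ (tr-away p q) (tr-away p′ q′) lt)

∑ : ℕ → (ℕ → ℕ) → ℕ
∑ zero    g = 0
∑ (suc N) g = g (suc N) + ∑ N g

∑-cong : ∀ N {g h} → (∀ {i} → 1 ≤ i → i ≤ N → g i ≡ h i) → ∑ N g ≡ ∑ N h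
∑-cong zero    g≡h = refl
∑-cong (suc N) g≡h = cong₂ _+_ (g≡h (s≤s z≤n) ≤-refl) (∑-cong N (λ p q → g≡h p (m≤n⇒m≤1+n q)))

∑-mono-≤ : ∀ N {g h} → (∀ {i} → 1 ≤ i → i ≤ N → g i ≤ h i) → ∑ N g ≤ ∑ N h
∑-mono-≤ zero    g≤h = z≤n
∑-mono-≤ (suc N) g≤h = +-mono-≤ (g≤h (s≤s z≤n) ≤-refl) (∑-mono-≤ N (λ p q → g≤h p (m≤n⇒m≤1+n q)))

∑-zero : ∀ N {g} → (∀ {i} → 1 ≤ i → i ≤ N → g i ≡ 0) → ∑ N g ≡ 0
∑-zero zero    g≡0 = refl
∑-zero (suc N) g≡0 = cong₂ _+_ (g≡0 (s≤s z≤n) ≤-refl) (∑-zero N (λ p q → g≡0 p (m≤n⇒m≤1+n q)))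

∑-distrib-+ : ∀ N g h → ∑ N (λ i → g i + h i) ≡ ∑ N g + ∑ N h
∑-distrib-+ zero    g h = refl
∑-distrib-+ (suc N) g h =
  trans (cong (g (suc N) + h (suc N) +_) (∑-distrib-+ N g h)) (interchange (g (suc N)) _ _ _)

∑-*-distribˡ : ∀ N c g → ∑ N (λ i → c * g i) ≡ c * ∑ N g
∑-*-distribˡ zero    c g = sym (*-zeroʳ c)
∑-*-distribˡ (suc N) c g =
  trans (cong (c * g (suc N) +_) (∑-*-distribˡ N c g)) (sym (*-distribˡ-+ c (g (suc N)) (∑ N g)))

sum-map-range1 : ∀ h n → sum (map h (range 1 n)) ≡ ∑ n h
sum-map-range1 h n = trans (cong (sum ∘ map h) (range1≡applyUpTo n)) (sum-map-applyUpTo h n)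
  where
  range1≡applyUpTo : ∀ n → range 1 n ≡ applyUpTo suc n
  range1≡applyUpTo n = filter-all (1 ≤?_) (applyUpTo⁺₂ suc n (λ _ → s≤s z≤n))

  sum-map-applyUpTo : ∀ h n → sum (map h (applyUpTo suc n)) ≡ ∑ n h
  sum-map-applyUpTo h zero    = refl
  sum-map-applyUpTo h (suc n) = begin
    sum (map h (applyUpTo suc (suc n)))             ≡⟨ cong (sum ∘ map h) (applyUpTo-∷ʳ suc n) ⟨
    sum (map h (applyUpTo suc n ∷ʳ suc n))          ≡⟨ cong sum (map-++ h (applyUpTo suc n) _) ⟩
    sum (map h (applyUpTo suc n) ++ h (suc n) ∷ []) ≡⟨ sum-++ (map h (applyUpTo suc n)) _ ⟩
    sum (map h (applyUpTo suc n)) + (h (suc n) + 0) ≡⟨ cong₂ _+_ (sum-map-applyUpTo h n) (+-identityʳ _) ⟩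
    ∑ n h + h (suc n)                               ≡⟨ +-comm (∑ n h) _ ⟩
    ∑ (suc n) h                                     ∎
    where open ≡-Reasoning

𝟙 : Bool → ℕ
𝟙 b = if b then 1 else 0

𝟙-∧ : ∀ x y → 𝟙 (x ∧ y) ≡ 𝟙 x * 𝟙 y
𝟙-∧ false y     = refl
𝟙-∧ true  false = refl
𝟙-∧ true  true  = refl

𝟙-≤-+ : ∀ {x y z} → (T x → T y ⊎ T z) → 𝟙 x ≤ 𝟙 y + 𝟙 z
𝟙-≤-+ {false}                 _ = z≤n
𝟙-≤-+ {true} {true}           _ = s≤s z≤n
𝟙-≤-+ {true} {false} {true}   _ = ≤-refl
𝟙-≤-+ {true} {false} {false} h with h tt
... | inj₁ ()
... | inj₂ ()

∑² : ℕ → (ℕ → ℕ → Bool) → ℕ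
∑² N X = ∑ N λ j → ∑ N λ i → 𝟙 (X i j)

inversions : (ℕ → ℕ) → ℕ → ℕ
inversions f N = ∑² N λ i j → (i <ᵇ j) ∧ (f j <ᵇ f i)

∑²-≤-+1 : ∀ N (X Y : ℕ → ℕ → Bool) (P Q : ℕ → Bool)
        → (∀ i j → T (X i j) → T (Y i j) ⊎ T (P j ∧ Q i))
        → ∑ N (𝟙 ∘ P) ≤ 1 → ∑ N (𝟙 ∘ Q) ≤ 1
        → ∑² N X ≤ ∑² N Y + 1
∑²-≤-+1 N X Y P Q X⇒Y∨PQ P≤1 Q≤1 = begin
  ∑² N X                                              ≤⟨ ∑-mono-≤ N (λ _ _ → ∑-mono-≤ N (λ _ _ → 𝟙-≤-+ (X⇒Y∨PQ _ _))) ⟩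
  ∑ N (λ j → ∑ N λ i → 𝟙 (Y i j) + 𝟙 (P j ∧ Q i))    ≡⟨ ∑-cong N (λ _ _ → ∑-distrib-+ N _ _) ⟩
  ∑ N (λ j → ∑ N (λ i → 𝟙 (Y i j)) + ∑ N λ i → 𝟙 (P j ∧ Q i)) ≡⟨ ∑-distrib-+ N _ _ ⟩
  ∑² N Y + ∑² N (λ i j → P j ∧ Q i)                   ≤⟨ +-monoʳ-≤ (∑² N Y) PQ≤1 ⟩
  ∑² N Y + 1                                          ∎
  where
  open ≤-Reasoning
  cQ = ∑ N (𝟙 ∘ Q)
  PQ≤1 : ∑² N (λ i j → P j ∧ Q i) ≤ 1
  PQ≤1 = begin
    ∑² N (λ i j → P j ∧ Q i)           ≡⟨ ∑-cong N (λ {j} _ _ → trans (∑-cong N (λ {i} _ _ → 𝟙-∧ (P j) (Q i)))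
                                                                        (∑-*-distribˡ N (𝟙 (P j)) (𝟙 ∘ Q))) ⟩
    ∑ N (λ j → 𝟙 (P j) * cQ)           ≡⟨ ∑-cong N (λ {j} _ _ → *-comm (𝟙 (P j)) cQ) ⟩
    ∑ N (λ j → cQ * 𝟙 (P j))           ≡⟨ ∑-*-distribˡ N cQ (𝟙 ∘ P) ⟩
    cQ * ∑ N (𝟙 ∘ P)                   ≤⟨ *-mono-≤ Q≤1 P≤1 ⟩
    1                                  ∎

count-≡ᵇ-≤1 : ∀ (f : ℕ → ℕ) → Injective _≡_ _≡_ f → ∀ m N → ∑ N (λ i → 𝟙 (f i ≡ᵇ m)) ≤ 1
count-≡ᵇ-≤1 f inj m zero = z≤n
count-≡ᵇ-≤1 f inj m (suc N) with f (suc N) ≡ᵇ m in eq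
... | false = count-≡ᵇ-≤1 f inj m N
... | true  = ≤-reflexive (cong suc (∑-zero N λ _ i≤N → cong 𝟙 (≢⇒≡ᵇ≡false λ fi≡m →
                <⇒≢ (s≤s i≤N) (inj (trans fi≡m (sym (≡ᵇ⇒≡ _ _ (subst T (sym eq) tt))))))))

-- Length as an inversion count

fun-injective : ∀ w {x y} → fun w x ≡ fun w y → x ≡ y
fun-injective w {x} {y} e = trans (sym (inv-fun w x)) (trans (cong (inv w) e) (inv-fun w y))

fun-≤ : ∀ w {N i} → bound w ≤ N → i ≤ N → fun w i ≤ N
fun-≤ w {N} {i} b≤N i≤N with i ≤? bound w
... | no  i≰b = subst (_≤ N) (sym (fixed w i (≰⇒> i≰b))) i≤N
... | yes i≤b with fun w i ≤? bound w
...   | yes wi≤b = ≤-trans wi≤b b≤N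
...   | no  wi≰b = contradiction (subst (_≤ bound w) (sym (fun-injective w (fixed w _ (≰⇒> wi≰b)))) i≤b) wi≰b

<ᵇ-true : ∀ {m n} → m < n → (m <ᵇ n) ≡ true
<ᵇ-true m<n = Equivalence.to T-≡ (<⇒<ᵇ m<n)

<ᵇ-false : ∀ {m n} → n ≤ m → (m <ᵇ n) ≡ false
<ᵇ-false {m} {n} n≤m with m <ᵇ n in eq
... | false = refl
... | true  = contradiction (<ᵇ⇒< m n (subst T (sym eq) tt)) (≤⇒≯ n≤m)

triangle : (ℕ → ℕ) → ℕ → ℕ
triangle f N = ∑ N λ j → ∑ (pred j) λ i → 𝟙 (f j <ᵇ f i)

ℓ≡triangle : ∀ w → ℓ w ≡ triangle (fun w) (bound w)
ℓ≡triangle w = trans (sum-map-range1 _ (bound w))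
                     (∑-cong (bound w) λ {j} _ _ → sum-map-range1 (λ i → 𝟙 (fun w j <ᵇ fun w i)) (pred j))

-- Rows beyond the support contribute no inversions.
triangle-stable : ∀ w {N} → bound w ≤ N → triangle (fun w) N ≡ triangle (fun w) (bound w)
triangle-stable w {N} b≤N with m≤n⇒m<n∨m≡n b≤N
... | inj₂ refl = refl
triangle-stable w {suc N} _ | inj₁ b<1+N =
  trans (cong (_+ triangle (fun w) N) (∑-zero N λ _ i≤N → cong 𝟙 (<ᵇ-false (wi≤w[1+N] i≤N))))
        (triangle-stable w (≤-pred b<1+N))
  where
  wi≤w[1+N] : ∀ {i} → i ≤ N → fun w i ≤ fun w (suc N)
  wi≤w[1+N] i≤N = ≤-trans (fun-≤ w (≤-pred b<1+N) i≤N) (≤-trans (n≤1+n N) (≤-reflexive (sym (fixed w (suc N) b<1+N))))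

triangle≡inversions : ∀ f N → triangle f N ≡ inversions f N
triangle≡inversions f N =
  ∑-cong N λ { {suc j} _ 1+j≤N → sym (below (λ i → f (suc j) <ᵇ f i) N (≤-trans (n≤1+n j) 1+j≤N)) }
  where
  below : ∀ (X : ℕ → Bool) M {j} → j ≤ M → ∑ M (λ i → 𝟙 ((i <ᵇ suc j) ∧ X i)) ≡ ∑ j (𝟙 ∘ X)
  below X M {j} j≤M with m≤n⇒m<n∨m≡n j≤M
  ... | inj₂ refl = ∑-cong j λ {i} _ i≤j → cong (λ b → 𝟙 (b ∧ X i)) (<ᵇ-true (s≤s i≤j))
  below X (suc M) {j} _ | inj₁ j<1+M =
    trans (cong (λ b → 𝟙 (b ∧ X (suc M)) + ∑ M (λ i → 𝟙 ((i <ᵇ suc j) ∧ X i))) (<ᵇ-false (s≤s (≤-pred j<1+M))))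
          (below X M (≤-pred j<1+M))

ℓ≡inversions : ∀ w {N} → bound w ≤ N → ℓ w ≡ inversions (fun w) N
ℓ≡inversions w {N} b≤N =
  trans (ℓ≡triangle w) (trans (sym (triangle-stable w b≤N)) (triangle≡inversions (fun w) N))

ℓ-cong : ∀ u v → fun u ≗ fun v → ℓ u ≡ ℓ v
ℓ-cong u v u≗v = begin
  ℓ u                  ≡⟨ ℓ≡inversions u (m≤m⊔n _ (bound v)) ⟩
  inversions (fun u) N ≡⟨ ∑-cong N (λ {j} _ _ → ∑-cong N λ {i} _ _ →
                            cong₂ (λ x y → 𝟙 ((i <ᵇ j) ∧ (x <ᵇ y))) (u≗v j) (u≗v i)) ⟩
  inversions (fun v) N ≡⟨ ℓ≡inversions v (m≤n⊔m (bound u) _) ⟨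
  ℓ v                  ∎
  where
  open ≡-Reasoning
  N = bound u ⊔ bound v

-- The only inversion of tr a ∘ f that is not one of f is the pair of positions with values a + 1, a.
inversions-tr∘-≤ : ∀ a f → Injective _≡_ _≡_ f → ∀ N → inversions (tr a ∘ f) N ≤ inversions f N + 1
inversions-tr∘-≤ a f f-inj N =
  ∑²-≤-+1 N _ _ (λ j → f j ≡ᵇ suc a) (λ i → f i ≡ᵇ a) new-inversion
          (count-≡ᵇ-≤1 f f-inj (suc a) N) (count-≡ᵇ-≤1 f f-inj a N)
  where
  new-inversion : ∀ i j → T ((i <ᵇ j) ∧ (tr a (f j) <ᵇ tr a (f i)))
                → T ((i <ᵇ j) ∧ (f j <ᵇ f i)) ⊎ T ((f j ≡ᵇ suc a) ∧ (f i ≡ᵇ a))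
  new-inversion i j t with Equivalence.to T-∧ t
  ... | i<j , lt with tr-reflects-< a (f j) (f i) (<ᵇ⇒< _ _ lt)
  ...   | inj₁ fj<fi         = inj₁ (Equivalence.from T-∧ (i<j , <⇒<ᵇ fj<fi))
  ...   | inj₂ (e₁ , e₂)     = inj₂ (Equivalence.from T-∧ (≡⇒≡ᵇ _ _ e₁ , ≡⇒≡ᵇ _ _ e₂))

∑-tr-reindex : ∀ b g N → suc (suc b) ≤ N → ∑ N (g ∘ tr (suc b)) ≡ ∑ N g
∑-tr-reindex b g N 2+b≤N with m≤n⇒m<n∨m≡n 2+b≤N
... | inj₂ refl = begin
  g (τ (2 + b)) + (g (τ (1 + b)) + ∑ b (g ∘ τ)) ≡⟨ cong₂ (λ x y → g x + (g y + ∑ b (g ∘ τ))) (tr-next (suc b)) (tr-at (suc b)) ⟩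
  g (1 + b) + (g (2 + b) + ∑ b (g ∘ τ))         ≡⟨ cong (λ z → g (1 + b) + (g (2 + b) + z)) (∑-cong b λ _ i≤b → cong g (fixes i≤b)) ⟩
  g (1 + b) + (g (2 + b) + ∑ b g)               ≡⟨ +-assoc (g (1 + b)) _ _ ⟨
  g (1 + b) + g (2 + b) + ∑ b g                 ≡⟨ cong (_+ ∑ b g) (+-comm (g (1 + b)) _) ⟩
  g (2 + b) + g (1 + b) + ∑ b g                 ≡⟨ +-assoc (g (2 + b)) _ _ ⟩
  g (2 + b) + (g (1 + b) + ∑ b g)               ∎
  where
  open ≡-Reasoning
  τ = tr (suc b)
  fixes : ∀ {i} → i ≤ b → τ i ≡ i
  fixes i≤b = tr-away (<⇒≢ (s≤s i≤b)) (<⇒≢ (s≤s (m≤n⇒m≤1+n i≤b)))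
∑-tr-reindex b g (suc M) _ | inj₁ 2+b<1+M =
  cong₂ _+_ (cong g (tr-away (>⇒≢ (<-trans (n<1+n _) 2+b<1+M)) (>⇒≢ 2+b<1+M)))
            (∑-tr-reindex b g M (≤-pred 2+b<1+M))

∑²-tr-reindex : ∀ b X N → suc (suc b) ≤ N → ∑² N (λ i j → X (tr (suc b) i) (tr (suc b) j)) ≡ ∑² N X
∑²-tr-reindex b X N 2+b≤N =
  trans (∑-cong N (λ {j} _ _ → ∑-tr-reindex b (λ i → 𝟙 (X i (tr (suc b) j))) N 2+b≤N))
        (∑-tr-reindex b (λ j → ∑ N λ i → 𝟙 (X i j)) N 2+b≤N)

-- After reindexing both sums by τ, the only new inversion is the pair of positions b + 1, b + 2.
inversions-∘tr-≤ : ∀ b f N → suc (suc b) ≤ N → inversions (f ∘ tr (suc b)) N ≤ inversions f N + 1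
inversions-∘tr-≤ b f N 2+b≤N = begin
  inversions (f ∘ τ) N ≡⟨ ∑-cong N (λ {j} _ _ → ∑-cong N λ {i} _ _ →
                            cong₂ (λ x y → 𝟙 ((x <ᵇ y) ∧ (f (τ j) <ᵇ f (τ i))))
                                  (sym (tr-involutive (suc b) i)) (sym (tr-involutive (suc b) j))) ⟩
  ∑² N (λ i j → X (τ i) (τ j)) ≡⟨ ∑²-tr-reindex b X N 2+b≤N ⟩
  ∑² N X               ≤⟨ ∑²-≤-+1 N X _ (λ j → j ≡ᵇ suc b) (λ i → i ≡ᵇ suc (suc b)) new-inversion
                                 (count-≡ᵇ-≤1 id id (suc b) N) (count-≡ᵇ-≤1 id id (suc (suc b)) N) ⟩
  inversions f N + 1   ∎
  where
  open ≤-Reasoning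
  τ = tr (suc b)
  X : ℕ → ℕ → Bool
  X i j = (τ i <ᵇ τ j) ∧ (f j <ᵇ f i)
  new-inversion : ∀ i j → T (X i j) → T ((i <ᵇ j) ∧ (f j <ᵇ f i)) ⊎ T ((j ≡ᵇ suc b) ∧ (i ≡ᵇ suc (suc b)))
  new-inversion i j t with Equivalence.to T-∧ t
  ... | lt , fj<fi with tr-reflects-< (suc b) i j (<ᵇ⇒< _ _ lt)
  ...   | inj₁ i<j       = inj₁ (Equivalence.from T-∧ (<⇒<ᵇ i<j , fj<fi))
  ...   | inj₂ (e₁ , e₂) = inj₂ (Equivalence.from T-∧ (≡⇒≡ᵇ _ _ e₂ , ≡⇒≡ᵇ _ _ e₁))

ℓ-s·≤ : ∀ a w → ℓ (s a · w) ≤ ℓ w + 1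
ℓ-s·≤ zero    w = ≤-trans (≤-reflexive (ℓ-cong (s zero · w) w λ _ → refl)) (m≤m+n (ℓ w) 1)
ℓ-s·≤ (suc b) w = begin
  ℓ (s (suc b) · w)                ≡⟨ ℓ≡inversions (s (suc b) · w) ≤-refl ⟩
  inversions (tr (suc b) ∘ fun w) N ≤⟨ inversions-tr∘-≤ (suc b) (fun w) (fun-injective w) N ⟩
  inversions (fun w) N + 1         ≡⟨ cong (_+ 1) (ℓ≡inversions w (m≤n⊔m (suc (suc b)) (bound w))) ⟨
  ℓ w + 1                          ∎
  where
  open ≤-Reasoning
  N = bound (s (suc b) · w)

ℓ-·s≤ : ∀ a u → ℓ (u · s a) ≤ ℓ u + 1
ℓ-·s≤ zero    u = ≤-trans (≤-reflexive (ℓ-cong (u · s zero) u λ _ → refl)) (m≤m+n (ℓ u) 1)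
ℓ-·s≤ (suc b) u = begin
  ℓ (u · s (suc b))                ≡⟨ ℓ≡inversions (u · s (suc b)) ≤-refl ⟩
  inversions (fun u ∘ tr (suc b)) N ≤⟨ inversions-∘tr-≤ b (fun u) N (m≤n⊔m (bound u) _) ⟩
  inversions (fun u) N + 1         ≡⟨ cong (_+ 1) (ℓ≡inversions u (m≤m⊔n _ (suc (suc b)))) ⟨
  ℓ u + 1                          ∎
  where
  open ≤-Reasoning
  N = bound (u · s (suc b))

-- Coxeter relations

tr-fixes-< : ∀ {a n} → n < a → tr a n ≡ n
tr-fixes-< n<a = tr-away (<⇒≢ n<a) (<⇒≢ (m<n⇒m<1+n n<a))

tr-fixes-> : ∀ {a n} → suc a < n → tr a n ≡ n
tr-fixes-> 1+a<n = tr-away (>⇒≢ (<-trans (n<1+n _) 1+a<n)) (>⇒≢ 1+a<n)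

tr-comm : ∀ {a b} → suc b < a → ∀ n → tr a (tr b n) ≡ tr b (tr a n)
tr-comm {a} {b} 1+b<a n with trView b n
... | at refl   rewrite tr-at b   | tr-fixes-< 1+b<a | tr-fixes-< (<-trans (n<1+n b) 1+b<a) | tr-at b = refl
... | next refl rewrite tr-next b | tr-fixes-< (<-trans (n<1+n b) 1+b<a) | tr-fixes-< 1+b<a | tr-next b = refl
... | away p q  rewrite tr-away p q with trView a n
...   | at refl   rewrite tr-at n   = sym (tr-fixes-> {b} (<-trans 1+b<a (n<1+n n)))
...   | next refl rewrite tr-next a = sym (tr-fixes-> {b} 1+b<a)
...   | away p′ q′ rewrite tr-away p′ q′ = sym (tr-away p q)

tr-braid : ∀ c n → tr c (tr (suc c) (tr c n)) ≡ tr (suc c) (tr c (tr (suc c) n))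
tr-braid c n with trView c n
... | at refl rewrite tr-fixes-< {suc c} (n<1+n c) | tr-at c | tr-at (suc c) | tr-fixes-> {c} (n<1+n (suc c)) = refl
... | next refl rewrite tr-next c | tr-fixes-< {suc c} (n<1+n c) | tr-at c | tr-at (suc c)
                    | tr-fixes-> {c} (n<1+n (suc c)) | tr-next (suc c) = refl
... | away p q with trView (suc c) n
...   | at n≡1+c = contradiction n≡1+c q
...   | next refl rewrite tr-fixes-> {c} (n<1+n (suc c)) | tr-next (suc c) | tr-next c | tr-fixes-< {suc c} (n<1+n c) = refl
...   | away p′ q′ rewrite tr-away p q | tr-away p′ q′ | tr-away p q | tr-away p′ q′ = refl

s-involutive : ∀ a n → fun (s a) (fun (s a) n) ≡ n
s-involutive zero    n = refl
s-involutive (suc a) n = tr-involutive (suc a) n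

s-comm : ∀ {a b} → suc b < a → ∀ n → fun (s a) (fun (s b) n) ≡ fun (s b) (fun (s a) n)
s-comm {a}     {zero}  _     n = refl
s-comm {suc a} {suc b} 2+b<a n = tr-comm 2+b<a n

⟦_⟧ : List ℕ → Perm
⟦ [] ⟧    = idP
⟦ a ∷ x ⟧ = s a · ⟦ x ⟧

infix 4 _≈_
record _≈_ (x y : List ℕ) : Set where
  constructor mk≈
  field ≈-app : fun ⟦ x ⟧ ≗ fun ⟦ y ⟧
open _≈_ public

≈-isEquivalence : IsEquivalence _≈_
≈-isEquivalence = record
  { refl  = mk≈ λ _ → refl
  ; sym   = λ x≈y → mk≈ λ n → sym (≈-app x≈y n)
  ; trans = λ x≈y y≈z → mk≈ λ n → trans (≈-app x≈y n) (≈-app y≈z n)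
  }

≈-setoid : Setoid _ _
≈-setoid = record { isEquivalence = ≈-isEquivalence }

open IsEquivalence ≈-isEquivalence public
  using () renaming (refl to ≈-refl; sym to ≈-sym; trans to ≈-trans; reflexive to ≡⇒≈)

⟦⟧-++ : ∀ x y n → fun ⟦ x ++ y ⟧ n ≡ fun ⟦ x ⟧ (fun ⟦ y ⟧ n)
⟦⟧-++ []      y n = refl
⟦⟧-++ (a ∷ x) y n = cong (fun (s a)) (⟦⟧-++ x y n)

≈-++ˡ : ∀ z {x y} → x ≈ y → z ++ x ≈ z ++ y
≈-++ˡ z {x} {y} x≈y = mk≈ λ n →
  trans (⟦⟧-++ z x n) (trans (cong (fun ⟦ z ⟧) (≈-app x≈y n)) (sym (⟦⟧-++ z y n)))

≈-++ʳ : ∀ {x y} z → x ≈ y → x ++ z ≈ y ++ z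
≈-++ʳ {x} {y} z x≈y = mk≈ λ n → trans (⟦⟧-++ x z n) (trans (≈-app x≈y _) (sym (⟦⟧-++ y z n)))

∷-cong : ∀ a {x y} → x ≈ y → a ∷ x ≈ a ∷ y
∷-cong a = ≈-++ˡ (a ∷ [])

cancel : ∀ a x → a ∷ a ∷ x ≈ x
cancel a x = mk≈ λ n → s-involutive a (fun ⟦ x ⟧ n)

far-comm : ∀ {a b} x → suc b < a → a ∷ b ∷ x ≈ b ∷ a ∷ x
far-comm x 1+b<a = mk≈ λ n → s-comm 1+b<a (fun ⟦ x ⟧ n)

slide : ∀ a ys → All (λ z → suc z < a) ys → a ∷ ys ≈ ys ∷ʳ a
slide a []       []            = ≈-refl
slide a (z ∷ ys) (1+z<a ∷ far) = ≈-trans (far-comm ys 1+z<a) (∷-cong z (slide a ys far))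

braid : ∀ {c} x → 1 ≤ c → c ∷ suc c ∷ c ∷ x ≈ suc c ∷ c ∷ suc c ∷ x
braid {suc c} x _ = mk≈ λ n → tr-braid (suc c) (fun ⟦ x ⟧ n)

-- Reduced words

Reduced : List ℕ → Set
Reduced x = ℓ ⟦ x ⟧ ≡ length x

ℓ⟦⟧≤length : ∀ x → ℓ ⟦ x ⟧ ≤ length x
ℓ⟦⟧≤length []      = z≤n
ℓ⟦⟧≤length (a ∷ x) = ≤-trans (ℓ-s·≤ a ⟦ x ⟧) (≤-trans (+-monoˡ-≤ 1 (ℓ⟦⟧≤length x)) (≤-reflexive (+-comm _ 1)))

ℓ-++-≤ˡ : ∀ x y → ℓ ⟦ x ++ y ⟧ ≤ length x + ℓ ⟦ y ⟧
ℓ-++-≤ˡ []      y = ≤-refl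
ℓ-++-≤ˡ (a ∷ x) y = ≤-trans (ℓ-s·≤ a ⟦ x ++ y ⟧)
                           (≤-trans (+-monoˡ-≤ 1 (ℓ-++-≤ˡ x y)) (≤-reflexive (+-comm _ 1)))

ℓ-++-≤ʳ : ∀ x y → ℓ ⟦ x ++ y ⟧ ≤ ℓ ⟦ x ⟧ + length y
ℓ-++-≤ʳ x []      = ≤-trans (≤-reflexive (cong (ℓ ∘ ⟦_⟧) (++-identityʳ x))) (m≤m+n _ 0)
ℓ-++-≤ʳ x (b ∷ y) = begin
  ℓ ⟦ x ++ b ∷ y ⟧             ≡⟨ cong (ℓ ∘ ⟦_⟧) (++-assoc x (b ∷ []) y) ⟨
  ℓ ⟦ (x ∷ʳ b) ++ y ⟧          ≤⟨ ℓ-++-≤ʳ (x ∷ʳ b) y ⟩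
  ℓ ⟦ x ∷ʳ b ⟧ + length y      ≡⟨ cong (_+ length y) (ℓ-cong ⟦ x ∷ʳ b ⟧ (⟦ x ⟧ · s b) (⟦⟧-++ x (b ∷ []))) ⟩
  ℓ (⟦ x ⟧ · s b) + length y   ≤⟨ +-monoˡ-≤ (length y) (ℓ-·s≤ b ⟦ x ⟧) ⟩
  ℓ ⟦ x ⟧ + 1 + length y       ≡⟨ +-assoc (ℓ ⟦ x ⟧) 1 (length y) ⟩
  ℓ ⟦ x ⟧ + length (b ∷ y)     ∎
  where open ≤-Reasoning

Reduced-++⁻ʳ : ∀ x y → Reduced (x ++ y) → Reduced y
Reduced-++⁻ʳ x y red = ≤-antisym (ℓ⟦⟧≤length y) (+-cancelˡ-≤ (length x) _ _ (begin
  length x + length y   ≡⟨ length-++ x ⟨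
  length (x ++ y)       ≡⟨ red ⟨
  ℓ ⟦ x ++ y ⟧          ≤⟨ ℓ-++-≤ˡ x y ⟩
  length x + ℓ ⟦ y ⟧    ∎))
  where open ≤-Reasoning

Reduced-++⁻ˡ : ∀ x y → Reduced (x ++ y) → Reduced x
Reduced-++⁻ˡ x y red = ≤-antisym (ℓ⟦⟧≤length x) (+-cancelʳ-≤ (length y) _ _ (begin
  length x + length y   ≡⟨ length-++ x ⟨
  length (x ++ y)       ≡⟨ red ⟨
  ℓ ⟦ x ++ y ⟧          ≤⟨ ℓ-++-≤ʳ x y ⟩
  ℓ ⟦ x ⟧ + length y    ∎))
  where open ≤-Reasoning

Reduced-≈ : ∀ {x y} → x ≈ y → length x ≡ length y → Reduced x → Reduced y
Reduced-≈ {x} {y} x≈y |x|≡|y| red = trans (ℓ-cong ⟦ y ⟧ ⟦ x ⟧ (λ n → sym (≈-app x≈y n))) (trans red |x|≡|y|)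

ReducedWord : Perm → List ℕ → Set
ReducedWord w x = Reduced x × fun ⟦ x ⟧ ≗ fun w

ReducedWord-≈ : ∀ {w x y} → x ≈ y → length x ≡ length y → ReducedWord w x → ReducedWord w y
ReducedWord-≈ x≈y |x|≡|y| (red , spells) = Reduced-≈ x≈y |x|≡|y| red , λ n → trans (sym (≈-app x≈y n)) (spells n)

Reduced⇒¬≈-shorter : ∀ {x y} → Reduced x → x ≈ y → length y + 2 ≢ length x
Reduced⇒¬≈-shorter {x} {y} red x≈y |y|+2≡|x| = 1+n≰n (begin-strict
  length x      ≡⟨ red ⟨
  ℓ ⟦ x ⟧       ≡⟨ ℓ-cong ⟦ x ⟧ ⟦ y ⟧ (≈-app x≈y) ⟩
  ℓ ⟦ y ⟧       ≤⟨ ℓ⟦⟧≤length y ⟩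
  length y      <⟨ m<m+n (length y) (s≤s z≤n) ⟩
  length y + 2  ≡⟨ |y|+2≡|x| ⟩
  length x      ∎)
  where open ≤-Reasoning

-- Demazure products

demazure : List ℕ → Perm
demazure = foldr _⋆_ idP

ℓ-demazure≤length : ∀ x → ℓ (demazure x) ≤ length x
ℓ-demazure≤length []      = z≤n
ℓ-demazure≤length (a ∷ x) with ℓ (demazure x) <ᵇ ℓ (s a · demazure x)
... | true  = ≤-trans (ℓ-s·≤ a (demazure x))
                      (≤-trans (+-monoˡ-≤ 1 (ℓ-demazure≤length x)) (≤-reflexive (+-comm (length x) 1)))
... | false = m≤n⇒m≤1+n (ℓ-demazure≤length x)

Reduced⇒demazure : ∀ x → Reduced x → fun (demazure x) ≗ fun ⟦ x ⟧ × ℓ (demazure x) ≡ length x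
Reduced⇒demazure []      red = (λ _ → refl) , refl
Reduced⇒demazure (a ∷ x) red with Reduced⇒demazure x (Reduced-++⁻ʳ (a ∷ []) x red)
... | d≗x , ℓd≡|x| with ℓ (demazure x) <ᵇ ℓ (s a · demazure x) in eq
...   | true  = sa·d≗ , trans (ℓ-cong (s a · demazure x) ⟦ a ∷ x ⟧ sa·d≗) red
  where sa·d≗ = λ n → cong (fun (s a)) (d≗x n)
...   | false = contradiction (<⇒<ᵇ (subst₂ _<_ (sym ℓd≡|x|) ℓsa·d≡ (n<1+n (length x))))
                              (λ t → subst T eq t)
  where ℓsa·d≡ = sym (trans (ℓ-cong (s a · demazure x) ⟦ a ∷ x ⟧ (λ n → cong (fun (s a)) (d≗x n))) red)

demazure⇒Reduced : ∀ x → ℓ (demazure x) ≡ length x → Reduced x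
demazure⇒Reduced []      _    = refl
demazure⇒Reduced (a ∷ x) ℓd≡ with ℓ (demazure x) <ᵇ ℓ (s a · demazure x)
... | false = contradiction (≤-trans (s≤s (≤-reflexive (sym ℓd≡))) (s≤s (ℓ-demazure≤length x))) (<-irrefl refl)
... | true  = trans (sym (ℓ-cong (s a · demazure x) ⟦ a ∷ x ⟧ (cong (fun (s a)) ∘ proj₁ (Reduced⇒demazure x red-x)))) ℓd≡
  where
  red-x : Reduced x
  red-x = demazure⇒Reduced x (≤-antisym (ℓ-demazure≤length x) (+-cancelʳ-≤ 1 _ _ (begin
    length x + 1                 ≡⟨ +-comm (length x) 1 ⟩
    suc (length x)               ≡⟨ ℓd≡ ⟨
    ℓ (s a · demazure x)         ≤⟨ ℓ-s·≤ a (demazure x) ⟩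
    ℓ (demazure x) + 1           ∎)))
    where open ≤-Reasoning

-- Pushing a letter through a decreasing row

Decreasing : List ℕ → Set
Decreasing = AllPairs _>_

Positive : List ℕ → Set
Positive = All (λ z → 1 ≤ z)

pushRunʳ : ℕ → List ℕ → List ℕ × ℕ
pushRunʳ x [] = [] , x
pushRunʳ x (z ∷ zs) with suc z ≟ x
... | yes _ = x ∷ proj₁ (pushRunʳ z zs) , proj₂ (pushRunʳ z zs)
... | no _ = z ∷ zs , x

pushʳ-succ : ℕ → List ℕ → List ℕ × ℕ
pushʳ-succ c [] = c ∷ [] , suc c
pushʳ-succ c (z ∷ zs) with z ≟ c
... | yes _ = suc c ∷ z ∷ zs , suc c
... | no _ = c ∷ z ∷ zs , suc c

-- pushʳ c D = (E , c′) with c ∷ D ≈ E ∷ʳ c′ (pushʳ-≈): c commutes past the letters ≥ c + 2 of D; at the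
-- next letter y it slides to the end (y ≤ c - 2), braids with c + 1 (y = c + 1), or lets the last letter of
-- the run c - 1, c - 2, … leave instead (y = c - 1).  The case y = c, a collision, cannot occur in a
-- reduced word.  pushˡ is its inverse.
pushʳ : ℕ → List ℕ → List ℕ × ℕ
pushʳ c [] = [] , c
pushʳ c (y ∷ ys) with suc (suc c) ≤? y
... | yes _ = y ∷ proj₁ (pushʳ c ys) , proj₂ (pushʳ c ys)
... | no _ with y ≟ suc c
...   | yes _ = pushʳ-succ c ys
...   | no _ with y ≟ c
...     | yes _ = y ∷ ys , c
...     | no _ with suc y ≟ c
...       | yes _ = c ∷ proj₁ (pushRunʳ y ys) , proj₂ (pushRunʳ y ys)
...       | no _ = y ∷ ys , c

Collidesʳ : ℕ → List ℕ → Set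
Collidesʳ c [] = ⊥
Collidesʳ c (y ∷ ys) with suc (suc c) ≤? y
... | yes _ = Collidesʳ c ys
... | no _ = y ≡ c

pushRunʳ-length : ∀ x zs → length (proj₁ (pushRunʳ x zs)) ≡ length zs
pushRunʳ-length x [] = refl
pushRunʳ-length x (z ∷ zs) with suc z ≟ x
... | yes _ = cong suc (pushRunʳ-length z zs)
... | no _ = refl

pushʳ-succ-length : ∀ c zs → length (proj₁ (pushʳ-succ c zs)) ≡ suc (length zs)
pushʳ-succ-length c [] = refl
pushʳ-succ-length c (z ∷ zs) with z ≟ c
... | yes _ = refl
... | no _ = refl

pushʳ-length : ∀ c D → length (proj₁ (pushʳ c D)) ≡ length D
pushʳ-length c [] = refl
pushʳ-length c (y ∷ ys) with suc (suc c) ≤? y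
... | yes _ = cong suc (pushʳ-length c ys)
... | no _ with y ≟ suc c
...   | yes _ = pushʳ-succ-length c ys
...   | no _ with y ≟ c
...     | yes _ = refl
...     | no _ with suc y ≟ c
...       | yes _ = cong suc (pushRunʳ-length y ys)
...       | no _ = refl

All-<-weaken : ∀ {b b′} {zs : List ℕ} → b ≤ b′ → All (_< b) zs → All (_< b′) zs
All-<-weaken le = All.map (λ p → ≤-trans p le)

pushRunʳ-decreasing : ∀ x zs → Decreasing zs → All (_< x) zs
                    → Decreasing (proj₁ (pushRunʳ x zs)) × All (_< suc x) (proj₁ (pushRunʳ x zs))
pushRunʳ-decreasing x [] _ _ = [] , []
pushRunʳ-decreasing x (z ∷ zs) (a ∷ dec) (zx ∷ ax) with suc z ≟ x
... | yes refl = (proj₂ ih ∷ proj₁ ih) , (≤-refl ∷ All-<-weaken (n≤1+n (suc z)) (proj₂ ih))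
  where ih = pushRunʳ-decreasing z zs dec a
... | no _ = (a ∷ dec) , (m≤n⇒m≤1+n zx ∷ All-<-weaken (n≤1+n x) ax)

pushʳ-bounded : ∀ c D b → All (_< b) D → c < b → Decreasing D → All (_< b) (proj₁ (pushʳ c D))
pushʳ-bounded c [] b ab cb dec = []
pushʳ-bounded c (y ∷ ys) b (yb ∷ ab) cb (ay ∷ dec) with suc (suc c) ≤? y
... | yes _ = yb ∷ pushʳ-bounded c ys b ab cb dec
... | no _ with y ≟ suc c
...   | yes refl = helper ys ab
  where
  helper : ∀ zs → All (_< b) zs → All (_< b) (proj₁ (pushʳ-succ c zs))
  helper [] _ = cb ∷ []
  helper (z ∷ zs) (zb ∷ azs) with z ≟ c
  ... | yes _ = yb ∷ zb ∷ azs
  ... | no _ = cb ∷ zb ∷ azs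
...   | no _ with y ≟ c
...     | yes _ = yb ∷ ab
...     | no _ with suc y ≟ c
...       | yes refl = cb ∷ All-<-weaken (<⇒≤ cb) (proj₂ (pushRunʳ-decreasing y ys dec ay))
...       | no _ = yb ∷ ab

<-pred-≢ : ∀ {z c} → z < suc c → ¬ z ≡ c → z < c
<-pred-≢ {z} {c} lt ne = ≤∧≢⇒< (≤-pred lt) ne

pushʳ-decreasing : ∀ c D → Decreasing D → Decreasing (proj₁ (pushʳ c D))
pushʳ-decreasing c [] dec = []
pushʳ-decreasing c (y ∷ ys) (ay ∷ dec) with suc (suc c) ≤? y
... | yes le = pushʳ-bounded c ys y ay (≤-trans (n≤1+n _) le) dec ∷ pushʳ-decreasing c ys dec
... | no _ with y ≟ suc c
...   | yes refl = helper ys ay dec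
  where
  helper : ∀ zs → All (_< suc c) zs → Decreasing zs → Decreasing (proj₁ (pushʳ-succ c zs))
  helper [] _ _ = [] ∷ []
  helper (z ∷ zs) (zc ∷ azs) (az ∷ decz) with z ≟ c
  ... | yes _ = (zc ∷ azs) ∷ (az ∷ decz)
  ... | no ne = (<-pred-≢ zc ne ∷ All-<-weaken (<⇒≤ (<-pred-≢ zc ne)) az) ∷ (az ∷ decz)
...   | no _ with y ≟ c
...     | yes _ = ay ∷ dec
...     | no _ with suc y ≟ c
...       | yes refl = proj₂ (pushRunʳ-decreasing y ys dec ay) ∷ proj₁ (pushRunʳ-decreasing y ys dec ay)
...       | no _ = ay ∷ dec

pushRunʳ-positive : ∀ x zs → Positive zs → 1 ≤ x → Positive (proj₁ (pushRunʳ x zs)) × 1 ≤ proj₂ (pushRunʳ x zs)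
pushRunʳ-positive x [] _ px = [] , px
pushRunʳ-positive x (z ∷ zs) (pz ∷ pzs) px with suc z ≟ x
... | yes _ = (px ∷ proj₁ (pushRunʳ-positive z zs pzs pz)) , proj₂ (pushRunʳ-positive z zs pzs pz)
... | no _ = (pz ∷ pzs) , px

pushʳ-positive : ∀ c D → Positive D → 1 ≤ c → Positive (proj₁ (pushʳ c D)) × 1 ≤ proj₂ (pushʳ c D)
pushʳ-positive c [] _ pc = [] , pc
pushʳ-positive c (y ∷ ys) (py ∷ pys) pc with suc (suc c) ≤? y
... | yes _ = (py ∷ proj₁ (pushʳ-positive c ys pys pc)) , proj₂ (pushʳ-positive c ys pys pc)
... | no _ with y ≟ suc c
...   | yes refl = helper ys pys
  where
  helper : ∀ zs → Positive zs → Positive (proj₁ (pushʳ-succ c zs)) × 1 ≤ proj₂ (pushʳ-succ c zs)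
  helper [] _ = (pc ∷ []) , s≤s z≤n
  helper (z ∷ zs) pzs with z ≟ c
  ... | yes _ = (py ∷ pzs) , s≤s z≤n
  ... | no _ = (pc ∷ pzs) , s≤s z≤n
...   | no _ with y ≟ c
...     | yes _ = (py ∷ pys) , pc
...     | no _ with suc y ≟ c
...       | yes refl = (pc ∷ proj₁ (pushRunʳ-positive y ys pys py)) , proj₂ (pushRunʳ-positive y ys pys py)
...       | no _ = (py ∷ pys) , pc

far-below : ∀ {z x} zs → suc (suc z) ≤ x → All (_< z) zs → All (λ w → suc (suc w) ≤ x) (z ∷ zs)
far-below zs le a = le ∷ All.map (λ p → ≤-trans (s≤s p) (≤-trans (n≤1+n _) le)) a

pushRunʳ-≈ : ∀ x zs → Decreasing zs → All (_< x) zs → (x ∷ zs) ≈ (proj₁ (pushRunʳ x zs) ∷ʳ proj₂ (pushRunʳ x zs))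
pushRunʳ-≈ x [] _ _ = ≈-refl
pushRunʳ-≈ x (z ∷ zs) (az ∷ dec) (zx ∷ ax) with suc z ≟ x
... | yes refl = ∷-cong (suc z) (pushRunʳ-≈ z zs dec az)
... | no ne = slide x (z ∷ zs) (far-below zs (≤∧≢⇒< zx ne) az)

pushʳ-≈ : ∀ c D → Decreasing D → 1 ≤ c → ¬ Collidesʳ c D → (c ∷ D) ≈ (proj₁ (pushʳ c D) ∷ʳ proj₂ (pushʳ c D))
pushʳ-≈ c [] _ _ _ = ≈-refl
pushʳ-≈ c (y ∷ ys) (ay ∷ dec) pc ¬coll with suc (suc c) ≤? y
... | yes le = ≈-trans (≈-sym (far-comm ys le)) (∷-cong y (pushʳ-≈ c ys dec pc ¬coll))
... | no nle with y ≟ suc c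
...   | yes refl = helper ys ay dec
  where
  helper : ∀ zs → All (_< suc c) zs → Decreasing zs → (c ∷ suc c ∷ zs) ≈ (proj₁ (pushʳ-succ c zs) ∷ʳ proj₂ (pushʳ-succ c zs))
  helper [] _ _ = ≈-refl
  helper (z ∷ zs) (zc ∷ azs) (az ∷ decz) with z ≟ c
  ... | yes refl = ≈-trans (braid zs pc) (∷-cong (suc z) (∷-cong z (slide (suc z) zs (All.map (λ p → s≤s p) az))))
  ... | no ne = ∷-cong c (slide (suc c) (z ∷ zs) (far-below zs (s≤s (<-pred-≢ zc ne)) az))
...   | no ne1 with y ≟ c
...     | yes refl = contradiction refl ¬coll
...     | no ne2 with suc y ≟ c
...       | yes refl = ∷-cong (suc y) (pushRunʳ-≈ y ys dec ay)
...       | no ne3 = slide c (y ∷ ys) (far-below ys (≤∧≢⇒< (<-pred-≢ (<-pred-≢ (≰⇒> nle) ne1) ne2) ne3) ay)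

collidesʳ⇒shorter : ∀ c D → Collidesʳ c D → Σ (List ℕ) λ D′ → (c ∷ D) ≈ D′ × length D′ + 2 ≡ length (c ∷ D)
collidesʳ⇒shorter c [] ()
collidesʳ⇒shorter c (y ∷ ys) coll with suc (suc c) ≤? y
... | yes le = y ∷ proj₁ ih , ≈-trans (≈-sym (far-comm ys le)) (∷-cong y (proj₁ (proj₂ ih))) , cong suc (proj₂ (proj₂ ih))
  where ih = collidesʳ⇒shorter c ys coll
... | no _ with coll
...   | refl = ys , cancel y ys , +-comm (length ys) 2

pushRunˡ : ℕ → List ℕ → ℕ → Maybe (List ℕ)
pushRunˡ y [] c′ with y ≟ suc c′
... | yes _ = just (c′ ∷ [])
... | no _ = nothing
pushRunˡ y (z ∷ zs) c′ with y ≟ suc c′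
... | yes _ with suc (suc z) ≤? c′
...   | yes _ = just (c′ ∷ z ∷ zs)
...   | no _ = nothing
pushRunˡ y (z ∷ zs) c′ | no _ with suc z ≟ y
...   | yes _ = Maybe.map (z ∷_) (pushRunˡ z zs c′)
...   | no _ = nothing

pushˡ-pred : ℕ → List ℕ → ℕ → ℕ × List ℕ
pushˡ-pred y [] c′ = c′ , y ∷ []
pushˡ-pred y (z ∷ zs) c′ with suc z ≟ c′
... | yes _ = z , y ∷ z ∷ zs
... | no _ = c′ , y ∷ z ∷ zs

pushˡ : List ℕ → ℕ → ℕ × List ℕ
pushˡ [] c′ = c′ , []
pushˡ (y ∷ ys) c′ with suc c′ ≤? y
... | yes _ with pushRunˡ y ys c′
...   | just D = y , D
...   | nothing = proj₁ (pushˡ ys c′) , y ∷ proj₂ (pushˡ ys c′)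
pushˡ (y ∷ ys) c′ | no _ with y ≟ c′
...   | yes _ = pushˡ-pred y ys c′
...   | no _ with suc y ≟ c′
...     | yes _ = y , c′ ∷ ys
...     | no _ = c′ , y ∷ ys

CollidesˡAt : List ℕ → ℕ → Set
CollidesˡAt [] c′ = ⊤
CollidesˡAt (z ∷ zs) c′ = suc z ≢ c′

Collidesˡ : List ℕ → ℕ → Set
Collidesˡ [] c′ = ⊥
Collidesˡ (y ∷ ys) c′ with suc c′ ≤? y
... | yes _ = Collidesˡ ys c′
... | no _ with y ≟ c′
...   | yes _ = CollidesˡAt ys c′
...   | no _ = ⊥

pushʳ-above : ∀ c y D → suc (suc c) ≤ y → pushʳ c (y ∷ D) ≡ (y ∷ proj₁ (pushʳ c D) , proj₂ (pushʳ c D))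
pushʳ-above c y D le with suc (suc c) ≤? y
... | yes _ = refl
... | no p = ⊥-elim (p le)

pushʳ-onSucc : ∀ c D → pushʳ c (suc c ∷ D) ≡ pushʳ-succ c D
pushʳ-onSucc c D with suc (suc c) ≤? suc c
... | yes p = ⊥-elim (1+n≰n (≤-pred p))
... | no _ with suc c ≟ suc c
...   | yes _ = refl
...   | no p = ⊥-elim (p refl)

pushʳ-onPred : ∀ y D → pushʳ (suc y) (y ∷ D) ≡ (suc y ∷ proj₁ (pushRunʳ y D) , proj₂ (pushRunʳ y D))
pushʳ-onPred y D with suc (suc (suc y)) ≤? y
... | yes p = ⊥-elim (1+n≰n (≤-trans (≤-trans (n≤1+n (suc y)) (n≤1+n (suc (suc y)))) p))
... | no _ with y ≟ suc (suc y)
...   | yes p = ⊥-elim (<⇒≢ (≤-trans (n<1+n y) (n≤1+n _)) p)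
...   | no _ with y ≟ suc y
...     | yes p = ⊥-elim (1+n≢n (sym p))
...     | no _ with suc y ≟ suc y
...       | yes _ = refl
...       | no p = ⊥-elim (p refl)

pushʳ-farAbove : ∀ c y D → suc (suc y) ≤ c → pushʳ c (y ∷ D) ≡ (y ∷ D , c)
pushʳ-farAbove c y D le with suc (suc c) ≤? y
... | yes p = ⊥-elim (<-asym (≤-trans (n≤1+n _) p) (≤-trans (n≤1+n _) le))
... | no _ with y ≟ suc c
...   | yes refl = ⊥-elim (<-asym (≤-trans (n≤1+n _) le) (n<1+n c))
...   | no _ with y ≟ c
...     | yes refl = ⊥-elim (<-irrefl refl (≤-trans (n≤1+n _) le))
...     | no _ with suc y ≟ c
...       | yes refl = ⊥-elim (<-irrefl refl le)
...       | no _ = refl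

pushʳ-succ-≢ : ∀ c z zs → ¬ z ≡ c → pushʳ-succ c (z ∷ zs) ≡ (c ∷ z ∷ zs , suc c)
pushʳ-succ-≢ c z zs ne with z ≟ c
... | yes p = ⊥-elim (ne p)
... | no _ = refl

pushʳ-succ-≡ : ∀ c zs → pushʳ-succ c (c ∷ zs) ≡ (suc c ∷ c ∷ zs , suc c)
pushʳ-succ-≡ c zs with c ≟ c
... | yes _ = refl
... | no p = ⊥-elim (p refl)

pushˡ-run : ∀ y ys c′ D → suc c′ ≤ y → pushRunˡ y ys c′ ≡ just D → pushˡ (y ∷ ys) c′ ≡ (y , D)
pushˡ-run y ys c′ D le eq with suc c′ ≤? y
... | no p = ⊥-elim (p le)
... | yes _ with pushRunˡ y ys c′
...   | just D′ = cong (y ,_) (just-injective eq)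
...   | nothing = contradiction eq λ ()

pushˡ-skip : ∀ y ys c′ → suc c′ ≤ y → pushRunˡ y ys c′ ≡ nothing
           → pushˡ (y ∷ ys) c′ ≡ (proj₁ (pushˡ ys c′) , y ∷ proj₂ (pushˡ ys c′))
pushˡ-skip y ys c′ le eq with suc c′ ≤? y
... | no p = ⊥-elim (p le)
... | yes _ with pushRunˡ y ys c′
...   | nothing = refl
...   | just D′ = contradiction eq λ ()

pushˡ-pred-≡ : ∀ z zs → pushˡ (suc z ∷ z ∷ zs) (suc z) ≡ (z , suc z ∷ z ∷ zs)
pushˡ-pred-≡ z zs with suc (suc z) ≤? suc z
... | yes p = ⊥-elim (1+n≰n (≤-pred p))
... | no _ with suc z ≟ suc z
...   | no p = ⊥-elim (p refl)
...   | yes _ with suc z ≟ suc z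
...     | yes _ = refl
...     | no p = ⊥-elim (p refl)

pushˡ-onPred : ∀ y ys → pushˡ (y ∷ ys) (suc y) ≡ (y , suc y ∷ ys)
pushˡ-onPred y ys with suc (suc y) ≤? y
... | yes p = ⊥-elim (1+n≰n (≤-trans (n≤1+n _) p))
... | no _ with y ≟ suc y
...   | yes p = ⊥-elim (1+n≢n (sym p))
...   | no _ with suc y ≟ suc y
...     | yes _ = refl
...     | no p = ⊥-elim (p refl)

pushˡ-farAbove : ∀ y ys c′ → suc (suc y) ≤ c′ → pushˡ (y ∷ ys) c′ ≡ (c′ , y ∷ ys)
pushˡ-farAbove y ys c′ le with suc c′ ≤? y
... | yes p = ⊥-elim (<-asym p (≤-trans (n≤1+n (suc y)) le))
... | no _ with y ≟ c′
...   | yes refl = ⊥-elim (<-irrefl refl (≤-trans (n≤1+n _) le))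
...   | no _ with suc y ≟ c′
...     | yes refl = ⊥-elim (<-irrefl refl le)
...     | no _ = refl

pushRunˡ-[]-nothing : ∀ y c′ → ¬ y ≡ suc c′ → pushRunˡ y [] c′ ≡ nothing
pushRunˡ-[]-nothing y c′ ne with y ≟ suc c′
... | yes p = ⊥-elim (ne p)
... | no _ = refl

pushRunˡ-stop-nothing : ∀ z zs c′ → ¬ suc (suc z) ≤ c′ → pushRunˡ (suc c′) (z ∷ zs) c′ ≡ nothing
pushRunˡ-stop-nothing z zs c′ nle with suc c′ ≟ suc c′
... | no p = ⊥-elim (p refl)
... | yes _ with suc (suc z) ≤? c′
...   | yes p = ⊥-elim (nle p)
...   | no _ = refl

pushRunˡ-stop : ∀ z zs c′ → suc (suc z) ≤ c′ → pushRunˡ (suc c′) (z ∷ zs) c′ ≡ just (c′ ∷ z ∷ zs)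
pushRunˡ-stop z zs c′ le with suc c′ ≟ suc c′
... | no p = ⊥-elim (p refl)
... | yes _ with suc (suc z) ≤? c′
...   | yes _ = refl
...   | no p = ⊥-elim (p le)

pushRunˡ-[] : ∀ c′ → pushRunˡ (suc c′) [] c′ ≡ just (c′ ∷ [])
pushRunˡ-[] c′ with suc c′ ≟ suc c′
... | yes _ = refl
... | no p = ⊥-elim (p refl)

pushRunˡ-nothing : ∀ y z zs c′ → ¬ y ≡ suc c′ → ¬ suc z ≡ y → pushRunˡ y (z ∷ zs) c′ ≡ nothing
pushRunˡ-nothing y z zs c′ n1 n2 with y ≟ suc c′
... | yes p = ⊥-elim (n1 p)
... | no _ with suc z ≟ y
...   | yes p = ⊥-elim (n2 p)
...   | no _ = refl

pushRunˡ-step : ∀ z zs c′ → ¬ suc z ≡ suc c′ → pushRunˡ (suc z) (z ∷ zs) c′ ≡ Maybe.map (z ∷_) (pushRunˡ z zs c′)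
pushRunˡ-step z zs c′ n1 with suc z ≟ suc c′
... | yes p = ⊥-elim (n1 p)
... | no _ with suc z ≟ suc z
...   | yes _ = refl
...   | no p = ⊥-elim (p refl)

pushRunʳ-out-≤ : ∀ x zs → proj₂ (pushRunʳ x zs) ≤ x
pushRunʳ-out-≤ x [] = ≤-refl
pushRunʳ-out-≤ x (z ∷ zs) with suc z ≟ x
... | yes refl = ≤-trans (pushRunʳ-out-≤ z zs) (n≤1+n z)
... | no _ = ≤-refl

pushʳ-out-≤ : ∀ c D → proj₂ (pushʳ c D) ≤ suc c
pushʳ-out-≤ c [] = n≤1+n c
pushʳ-out-≤ c (y ∷ ys) with suc (suc c) ≤? y
... | yes _ = pushʳ-out-≤ c ys
... | no _ with y ≟ suc c
...   | yes _ = helper ys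
  where
  helper : ∀ zs → proj₂ (pushʳ-succ c zs) ≤ suc c
  helper [] = ≤-refl
  helper (z ∷ zs) with z ≟ c
  ... | yes _ = ≤-refl
  ... | no _ = ≤-refl
...   | no _ with y ≟ c
...     | yes _ = n≤1+n c
...     | no _ with suc y ≟ c
...       | yes refl = ≤-trans (pushRunʳ-out-≤ y ys) (≤-trans (n≤1+n y) (n≤1+n _))
...       | no _ = n≤1+n c

pushRunˡ-pushRunʳ : ∀ x zs → Decreasing zs → All (_< x) zs
                  → pushRunˡ (suc x) (proj₁ (pushRunʳ x zs)) (proj₂ (pushRunʳ x zs)) ≡ just (x ∷ zs)
pushRunˡ-pushRunʳ x [] _ _ = pushRunˡ-[] x
pushRunˡ-pushRunʳ x (z ∷ zs) (az ∷ dec) (zx ∷ ax) with suc z ≟ x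
... | yes refl = trans (pushRunˡ-step (suc z) (proj₁ (pushRunʳ z zs)) (proj₂ (pushRunʳ z zs))
                         (λ e → 1+n≰n (≤-trans (≤-reflexive (suc-injective e)) (pushRunʳ-out-≤ z zs))))
                       (cong (Maybe.map (suc z ∷_)) (pushRunˡ-pushRunʳ z zs dec az))
... | no ne = pushRunˡ-stop z zs x (≤∧≢⇒< zx ne)

pushRunˡ-blocked : ∀ y h t c′ → suc c′ ≤ y → h ≤ c′ → ¬ suc (suc h) ≤ c′ → pushRunˡ y (h ∷ t) c′ ≡ nothing
pushRunˡ-blocked y h t c′ le hc nle = by-cases (y ≟ suc c′)
  where
  by-cases : Dec (y ≡ suc c′) → pushRunˡ y (h ∷ t) c′ ≡ nothing
  by-cases (yes refl) = pushRunˡ-stop-nothing h t c′ nle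
  by-cases (no ne)    = pushRunˡ-nothing y h t c′ ne (λ e → ne (≤-antisym (≤-trans (≤-reflexive (sym e)) (s≤s hc)) le))

pushRunˡ-pushʳ-nothing : ∀ c ys y → All (_< y) ys → Decreasing ys → suc (suc c) ≤ y → ¬ Collidesʳ c ys
     → pushRunˡ y (proj₁ (pushʳ c ys)) (proj₂ (pushʳ c ys)) ≡ nothing
pushRunˡ-pushʳ-nothing c [] y _ _ le _ = pushRunˡ-[]-nothing y c (λ e → 1+n≰n (subst (suc (suc c) ≤_) e le))
pushRunˡ-pushʳ-nothing c (z ∷ zs) y (zy ∷ azy) (az ∷ dec) le ¬coll with suc (suc c) ≤? z
... | yes lez with suc z ≟ y
...   | yes refl = trans (pushRunˡ-step z (proj₁ (pushʳ c zs)) (proj₂ (pushʳ c zs))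
                           (λ e → <⇒≢ (≤-trans (s≤s (pushʳ-out-≤ c zs)) lez) (sym (suc-injective e))))
                         (cong (Maybe.map (z ∷_)) (pushRunˡ-pushʳ-nothing c zs z az dec lez ¬coll))
...   | no ne = pushRunˡ-nothing y z (proj₁ (pushʳ c zs)) (proj₂ (pushʳ c zs))
                  (λ e → <⇒≢ (≤-trans (s≤s (≤-trans (s≤s (pushʳ-out-≤ c zs)) lez)) zy) (sym e)) ne
pushRunˡ-pushʳ-nothing c (z ∷ zs) y (zy ∷ azy) (az ∷ dec) le ¬coll | no nlez with z ≟ suc c
...   | yes refl = helper zs az
  where
  helper : ∀ ws → All (_< suc c) ws → pushRunˡ y (proj₁ (pushʳ-succ c ws)) (proj₂ (pushʳ-succ c ws)) ≡ nothing
  helper [] _ = pushRunˡ-blocked y c [] (suc c) le (n≤1+n c) (λ p → 1+n≰n p)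
  helper (w ∷ ws) (wc ∷ _) with w ≟ c
  ... | yes refl = pushRunˡ-blocked y (suc w) (w ∷ ws) (suc w) le ≤-refl (λ p → 1+n≰n (≤-trans (n≤1+n _) p))
  ... | no _ = pushRunˡ-blocked y c (w ∷ ws) (suc c) le (n≤1+n c) (λ p → 1+n≰n p)
...   | no ne1 with z ≟ c
...     | yes refl = contradiction refl ¬coll
...     | no ne2 with suc z ≟ c
...       | yes refl = pushRunˡ-nothing y (suc z) (proj₁ (pushRunʳ z zs)) (proj₂ (pushRunʳ z zs))
                         (λ e → <⇒≢ (≤-trans (s≤s (s≤s (pushRunʳ-out-≤ z zs))) (≤-trans (n≤1+n _) le)) (sym e))
                         (λ e → <-irrefl e le)
...       | no ne3 = pushRunˡ-nothing y z zs c (λ e → <⇒≢ le (sym e))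
                         (λ e → <⇒≢ (≤-trans (s≤s (<-pred-≢ (<-pred-≢ (≰⇒> nlez) ne1) ne2)) (≤-trans (n≤1+n _) le)) e)

pushˡ-pushʳ : ∀ c D → Decreasing D → 1 ≤ c → ¬ Collidesʳ c D → pushˡ (proj₁ (pushʳ c D)) (proj₂ (pushʳ c D)) ≡ (c , D)
pushˡ-pushʳ c [] _ _ _ = refl
pushˡ-pushʳ c (y ∷ ys) (ay ∷ dec) pc ¬coll with suc (suc c) ≤? y
... | yes le = trans (pushˡ-skip y (proj₁ (pushʳ c ys)) (proj₂ (pushʳ c ys)) (≤-trans (s≤s (pushʳ-out-≤ c ys)) le)
                                 (pushRunˡ-pushʳ-nothing c ys y ay dec le ¬coll))
                     (cong (λ p → proj₁ p , y ∷ proj₂ p) (pushˡ-pushʳ c ys dec pc ¬coll))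
... | no nle with y ≟ suc c
...   | yes refl = helper ys
  where
  helper : ∀ ws → pushˡ (proj₁ (pushʳ-succ c ws)) (proj₂ (pushʳ-succ c ws)) ≡ (c , suc c ∷ ws)
  helper [] = pushˡ-onPred c []
  helper (w ∷ ws) with w ≟ c
  ... | yes refl = pushˡ-pred-≡ w ws
  ... | no _ = pushˡ-onPred c (w ∷ ws)
...   | no ne1 with y ≟ c
...     | yes refl = contradiction refl ¬coll
...     | no ne2 with suc y ≟ c
...       | yes refl = pushˡ-run (suc y) (proj₁ (pushRunʳ y ys)) (proj₂ (pushRunʳ y ys)) (y ∷ ys)
                                   (s≤s (pushRunʳ-out-≤ y ys)) (pushRunˡ-pushRunʳ y ys dec ay)
...       | no ne3 = pushˡ-farAbove y ys c (≤∧≢⇒< (<-pred-≢ (<-pred-≢ (≰⇒> nle) ne1) ne2) ne3)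

pushRunˡ-≥ : ∀ y ys c′ D → pushRunˡ y ys c′ ≡ just D → suc c′ ≤ y
pushRunˡ-≥ y [] c′ D eq with y ≟ suc c′
... | yes refl = ≤-refl
... | no _ = contradiction eq λ ()
pushRunˡ-≥ y (z ∷ zs) c′ D eq with y ≟ suc c′
... | yes refl = ≤-refl
... | no _ with suc z ≟ y
...   | no _ = contradiction eq λ ()
...   | yes refl with pushRunˡ z zs c′ in eq2
...     | just D0 = ≤-trans (pushRunˡ-≥ z zs c′ D0 eq2) (n≤1+n z)
...     | nothing = contradiction eq λ ()

pushRunʳ-step : ∀ z zs → pushRunʳ (suc z) (z ∷ zs) ≡ (suc z ∷ proj₁ (pushRunʳ z zs) , proj₂ (pushRunʳ z zs))
pushRunʳ-step z zs with suc z ≟ suc z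
... | yes _ = refl
... | no p = ⊥-elim (p refl)

pushRunʳ-stop : ∀ x z zs → ¬ suc z ≡ x → pushRunʳ x (z ∷ zs) ≡ (z ∷ zs , x)
pushRunʳ-stop x z zs ne with suc z ≟ x
... | yes p = ⊥-elim (ne p)
... | no _ = refl

pushRunˡ-just : ∀ y ys c′ D → pushRunˡ y ys c′ ≡ just D
              → Σ (List ℕ) λ rest → D ≡ pred y ∷ rest × pushRunʳ (pred y) rest ≡ (ys , c′)
pushRunˡ-just y [] c′ D eq with y ≟ suc c′
... | yes refl = [] , sym (just-injective eq) , refl
... | no _ = contradiction eq λ ()
pushRunˡ-just y (z ∷ zs) c′ D eq with y ≟ suc c′
... | yes refl with suc (suc z) ≤? c′
...   | yes le = z ∷ zs , sym (just-injective eq) , pushRunʳ-stop c′ z zs (λ e → <-irrefl e le)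
...   | no _ = contradiction eq λ ()
pushRunˡ-just y (z ∷ zs) c′ D eq | no _ with suc z ≟ y
...   | no _ = contradiction eq λ ()
...   | yes refl with pushRunˡ z zs c′ in eq2
...     | nothing = contradiction eq λ ()
...     | just D0 with pushRunˡ-just z zs c′ D0 eq2 | pushRunˡ-≥ z zs c′ D0 eq2
...       | rest0 , refl , req | s≤s _ =
  D0 , sym (just-injective eq) , trans (pushRunʳ-step (pred z) rest0) (cong (λ p → suc (pred z) ∷ proj₁ p , proj₂ p) req)

pushˡ-out-far : ∀ y ys c′ → suc c′ ≤ y → pushRunˡ y ys c′ ≡ nothing → All (_< y) ys → Decreasing ys → ¬ Collidesˡ ys c′
       → suc (suc (proj₁ (pushˡ ys c′))) ≤ y
pushˡ-out-far y [] c′ le eq _ _ _ = ≤∧≢⇒< le λ { refl → contradiction (trans (sym (pushRunˡ-[] c′)) eq) λ () }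
pushˡ-out-far y (z ∷ zs) c′ le eq (zy ∷ azy) (az ∷ dec) ¬coll with suc c′ ≤? z
... | yes lez with pushRunˡ z zs c′ in eq2
...   | just D = ≤∧≢⇒< zy λ { refl → contradiction (trans (sym just≡) eq) λ () }
  where just≡ = trans (pushRunˡ-step z zs c′ (λ e → <-irrefl (sym (suc-injective e)) lez)) (cong (Maybe.map (z ∷_)) eq2)
...   | nothing = ≤-trans (pushˡ-out-far z zs c′ lez eq2 az dec ¬coll) (<⇒≤ zy)
pushˡ-out-far y (z ∷ zs) c′ le eq (zy ∷ azy) (az ∷ dec) ¬coll | no nlez with z ≟ c′
...   | yes refl = helper zs ¬coll
  where
  helper : ∀ ws → ¬ CollidesˡAt ws z → suc (suc (proj₁ (pushˡ-pred z ws z))) ≤ y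
  helper [] b = ⊥-elim (b tt)
  helper (w ∷ ws) b with suc w ≟ z
  ... | yes refl = le
  ... | no ne = contradiction ne b
...   | no ne with suc z ≟ c′
...     | yes refl = le
...     | no ne2 = ≤∧≢⇒< le λ { refl →
                 contradiction (trans (sym (pushRunˡ-stop z zs c′ (≤∧≢⇒< (<-pred-≢ (≰⇒> nlez) ne) ne2))) eq) λ () }

pushʳ-pushˡ : ∀ E c′ → Decreasing E → ¬ Collidesˡ E c′ → pushʳ (proj₁ (pushˡ E c′)) (proj₂ (pushˡ E c′)) ≡ (E , c′)
pushʳ-pushˡ [] c′ _ _ = refl
pushʳ-pushˡ (y ∷ ys) c′ (ay ∷ dec) ¬coll with suc c′ ≤? y
... | yes le with pushRunˡ y ys c′ in eq
...   | just D with pushRunˡ-just y ys c′ D eq | le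
...     | rest , refl , req | s≤s _ = trans (pushʳ-onPred (pred y) rest) (cong (λ p → suc (pred y) ∷ proj₁ p , proj₂ p) req)
pushʳ-pushˡ (y ∷ ys) c′ (ay ∷ dec) ¬coll | yes le | nothing =
  trans (pushʳ-above (proj₁ (pushˡ ys c′)) y (proj₂ (pushˡ ys c′)) (pushˡ-out-far y ys c′ le eq ay dec ¬coll))
        (cong (λ p → y ∷ proj₁ p , proj₂ p) (pushʳ-pushˡ ys c′ dec ¬coll))
pushʳ-pushˡ (y ∷ ys) c′ (ay ∷ dec) ¬coll | no nle with y ≟ c′
...   | yes refl = helper ys ay ¬coll
  where
  helper : ∀ ws → All (_< y) ws → ¬ CollidesˡAt ws y
         → pushʳ (proj₁ (pushˡ-pred y ws y)) (proj₂ (pushˡ-pred y ws y)) ≡ (y ∷ ws , y)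
  helper [] _ b = ⊥-elim (b tt)
  helper (w ∷ ws) _ b with suc w ≟ y
  ... | yes refl = trans (pushʳ-onSucc w (w ∷ ws)) (pushʳ-succ-≡ w ws)
  ... | no ne = contradiction ne b
...   | no ne with suc y ≟ c′
...     | yes refl = trans (pushʳ-onSucc y ys) (helper ys ay)
  where
  helper : ∀ ws → All (_< y) ws → pushʳ-succ y ws ≡ (y ∷ ws , suc y)
  helper [] _ = refl
  helper (w ∷ ws) (wy ∷ _) = pushʳ-succ-≢ y w ws (λ e → <-irrefl e wy)
...     | no ne2 = pushʳ-farAbove c′ y ys (≤∧≢⇒< (<-pred-≢ (≰⇒> nle) ne) ne2)

collidesʳ-below : ∀ c w ws → w < c → ¬ Collidesʳ c (w ∷ ws)
collidesʳ-below c w ws lt with suc (suc c) ≤? w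
... | yes p = ⊥-elim (<-asym lt (≤-trans (n≤1+n _) p))
... | no _ = λ e → <-irrefl e lt

collidesʳ-succ : ∀ c ws → ¬ Collidesʳ c (suc c ∷ ws)
collidesʳ-succ c ws with suc (suc c) ≤? suc c
... | yes p = ⊥-elim (1+n≰n (≤-pred p))
... | no _ = 1+n≢n

collidesʳ-above : ∀ c y ws → suc (suc c) ≤ y → Collidesʳ c (y ∷ ws) → Collidesʳ c ws
collidesʳ-above c y ws le with suc (suc c) ≤? y
... | yes _ = λ coll → coll
... | no p = ⊥-elim (p le)

record PushˡResult (E : List ℕ) (c′ : ℕ) (c : ℕ) (D : List ℕ) : Set where
  field
    decreasing : Decreasing D
    positive : Positive D
    1≤c : 1 ≤ c
    length≡ : length D ≡ length E
    ¬collides : ¬ Collidesʳ c D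
    bounded : ∀ b → All (_< b) E → c′ < b → All (_< b) D

pushRunˡ-props : ∀ y ys c′ D → pushRunˡ y ys c′ ≡ just D → Decreasing ys → All (_< y) ys → Positive ys → 1 ≤ c′
           → Decreasing D × All (_< y) D × Positive D × length D ≡ suc (length ys)
pushRunˡ-props y [] c′ D eq _ _ _ pc with y ≟ suc c′
... | yes refl with just-injective eq
...   | refl = ([] ∷ []) , (≤-refl ∷ []) , (pc ∷ []) , refl
pushRunˡ-props y [] c′ D eq _ _ _ pc | no _ = contradiction eq λ ()
pushRunˡ-props y (z ∷ zs) c′ D eq (az ∷ dec) ay pz pc with y ≟ suc c′
... | yes refl with suc (suc z) ≤? c′
...   | no _ = contradiction eq λ ()
...   | yes le with just-injective eq
...     | refl = ((≤-trans (n≤1+n _) le ∷ All.map (λ p → <-trans p (≤-trans (n≤1+n _) le)) az) ∷ az ∷ dec)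
                 , (≤-refl ∷ ay) , (pc ∷ pz) , refl
pushRunˡ-props y (z ∷ zs) c′ D eq (az ∷ dec) ay (pz1 ∷ pzs) pc | no _ with suc z ≟ y
...   | no _ = contradiction eq λ ()
...   | yes refl with pushRunˡ z zs c′ in eq2
...     | nothing = contradiction eq λ ()
...     | just D0 with just-injective eq | pushRunˡ-props z zs c′ D0 eq2 dec az pzs pc
...       | refl | sdD0 , aD0 , pD0 , lD0 = (aD0 ∷ sdD0) , (≤-refl ∷ All-<-weaken (n≤1+n z) aD0) , (pz1 ∷ pD0) , cong suc lD0

pushˡ-run-props : ∀ y ys c′ D → suc c′ ≤ y → pushRunˡ y ys c′ ≡ just D → Decreasing ys → All (_< y) ys → Positive ys → 1 ≤ c′
                → PushˡResult (y ∷ ys) c′ y D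
pushˡ-run-props y ys c′ D le eq dec ay pys pc with pushRunˡ-props y ys c′ D eq dec ay pys pc | pushRunˡ-just y ys c′ D eq
... | decreasing , aD , pD , lD | rest , refl , _ = record { decreasing = decreasing ; positive = pD ; 1≤c = ≤-trans (s≤s z≤n) le ; length≡ = lD
          ; ¬collides = collidesʳ-below y (pred y) rest (All.head aD) ; bounded = λ b ab cb → All.map (λ p → <-trans p (All.head ab)) aD }

pushˡ-props : ∀ E c′ → Decreasing E → Positive E → 1 ≤ c′ → ¬ Collidesˡ E c′
            → PushˡResult E c′ (proj₁ (pushˡ E c′)) (proj₂ (pushˡ E c′))
pushˡ-props [] c′ _ _ pc _ =
  record { decreasing = [] ; positive = [] ; 1≤c = pc ; length≡ = refl ; ¬collides = λ () ; bounded = λ b _ _ → [] }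
pushˡ-props (y ∷ ys) c′ (ay ∷ dec) (py ∷ pys) pc ¬coll with suc c′ ≤? y
... | yes le with pushRunˡ y ys c′ in eq
...   | just D = pushˡ-run-props y ys c′ D le eq dec ay pys pc
pushˡ-props (y ∷ ys) c′ (ay ∷ dec) (py ∷ pys) pc ¬coll | yes le | nothing =
  record { decreasing = bounded y ay le ∷ decreasing ; positive = py ∷ positive ; 1≤c = 1≤c ; length≡ = cong suc (length≡)
         ; ¬collides = ¬collides ∘ collidesʳ-above _ y _ (pushˡ-out-far y ys c′ le eq ay dec ¬coll)
         ; bounded = λ b ab cb → All.head ab ∷ bounded b (All.tail ab) cb }
  where open PushˡResult (pushˡ-props ys c′ dec pys pc ¬coll)
pushˡ-props (y ∷ ys) c′ (ay ∷ dec) (py ∷ pys) pc ¬coll | no nle with y ≟ c′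
...   | yes refl = helper ys ay dec pys ¬coll
  where
  helper : ∀ ws → All (_< y) ws → Decreasing ws → Positive ws → ¬ CollidesˡAt ws y
         → PushˡResult (y ∷ ws) y (proj₁ (pushˡ-pred y ws y)) (proj₂ (pushˡ-pred y ws y))
  helper [] _ _ _ b = ⊥-elim (b tt)
  helper (w ∷ ws) aw decw (pw ∷ pws) b with suc w ≟ y
  ... | yes refl = record { decreasing = aw ∷ decw ; positive = py ∷ pw ∷ pws ; 1≤c = pw ; length≡ = refl
                          ; ¬collides = collidesʳ-succ w (w ∷ ws) ; bounded = λ b ab _ → ab }
  ... | no ne = contradiction ne b
...   | no ne with suc y ≟ c′
...     | yes refl = record { decreasing = All-<-weaken (n≤1+n y) ay ∷ dec ; positive = pc ∷ pys ; 1≤c = py ; length≡ = refl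
                            ; ¬collides = collidesʳ-succ y ys
                            ; bounded = λ b ab cb → cb ∷ All.tail ab }
...     | no ne2 = record { decreasing = ay ∷ dec ; positive = py ∷ pys ; 1≤c = pc ; length≡ = refl
                          ; ¬collides = collidesʳ-below c′ y ys (<-pred-≢ (≰⇒> nle) ne) ; bounded = λ b ab _ → ab }

collidesˡ⇒shorter : ∀ E c′ → Decreasing E → Collidesˡ E c′ → Σ (List ℕ) λ E′ → (E ∷ʳ c′) ≈ E′ × length E′ + 2 ≡ suc (length E)
collidesˡ⇒shorter [] c′ _ ()
collidesˡ⇒shorter (y ∷ ys) c′ (ay ∷ dec) coll with suc c′ ≤? y
... | yes _ = y ∷ proj₁ ih , ∷-cong y (proj₁ (proj₂ ih)) , cong suc (proj₂ (proj₂ ih))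
  where ih = collidesˡ⇒shorter ys c′ dec coll
... | no nle with y ≟ c′
...   | no _ = ⊥-elim coll
...   | yes refl = helper ys ay dec coll
  where
  helper : ∀ ws → All (_< y) ws → Decreasing ws → CollidesˡAt ws y
         → Σ (List ℕ) λ E′ → (y ∷ ws ∷ʳ y) ≈ E′ × length E′ + 2 ≡ suc (length (y ∷ ws))
  helper [] _ _ _ = [] , cancel y [] , refl
  helper (w ∷ ws) (wy ∷ aw) (w>ws ∷ _) b with suc w ≟ y
  ... | yes refl = contradiction refl b
  ... | no ne = w ∷ ws
              , ≈-trans (∷-cong y (≈-sym (slide y (w ∷ ws) (far-below ws (≤∧≢⇒< wy ne) w>ws)))) (cancel y (w ∷ ws))
              , +-comm (length (w ∷ ws)) 2

¬collidesʳ : ∀ c D → Reduced (c ∷ D) → ¬ Collidesʳ c D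
¬collidesʳ c D red coll with collidesʳ⇒shorter c D coll
... | _ , ≈D′ , shorter = Reduced⇒¬≈-shorter red ≈D′ shorter

¬collidesˡ : ∀ E c′ → Decreasing E → Reduced (E ∷ʳ c′) → ¬ Collidesˡ E c′
¬collidesˡ E c′ dec red coll with collidesˡ⇒shorter E c′ dec coll
... | _ , ≈E′ , shorter = Reduced⇒¬≈-shorter red ≈E′ (trans shorter (sym (trans (length-++ E) (+-comm (length E) 1))))

ValidRow : List ℕ → Set
ValidRow D = Decreasing D × Positive D

record RowExchange (c : ℕ) (D E : List ℕ) (c′ : ℕ) : Set where
  field
    exchange : c ∷ D ≈ E ∷ʳ c′
    validˡ   : ValidRow D
    validʳ   : ValidRow E
    1≤c      : 1 ≤ c
    1≤c′     : 1 ≤ c′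
    length≡  : length E ≡ length D
    pushʳ≡   : pushʳ c D ≡ (E , c′)
    pushˡ≡   : pushˡ E c′ ≡ (c , D)

pushʳ-exchange : ∀ {c D} → ValidRow D → 1 ≤ c → Reduced (c ∷ D)
               → RowExchange c D (proj₁ (pushʳ c D)) (proj₂ (pushʳ c D))
pushʳ-exchange {c} {D} (dec , pos) 1≤c red = record
  { exchange = pushʳ-≈ c D dec 1≤c ¬coll
  ; validˡ   = dec , pos
  ; validʳ   = pushʳ-decreasing c D dec , proj₁ (pushʳ-positive c D pos 1≤c)
  ; 1≤c      = 1≤c
  ; 1≤c′     = proj₂ (pushʳ-positive c D pos 1≤c)
  ; length≡  = pushʳ-length c D
  ; pushʳ≡   = refl
  ; pushˡ≡   = pushˡ-pushʳ c D dec 1≤c ¬coll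
  }
  where ¬coll = ¬collidesʳ c D red

pushˡ-exchange : ∀ {E c′} → ValidRow E → 1 ≤ c′ → Reduced (E ∷ʳ c′)
               → RowExchange (proj₁ (pushˡ E c′)) (proj₂ (pushˡ E c′)) E c′
pushˡ-exchange {E} {c′} (dec , pos) 1≤c′ red = record
  { exchange = subst (λ p → proj₁ (pushˡ E c′) ∷ proj₂ (pushˡ E c′) ≈ proj₁ p ∷ʳ proj₂ p)
                     (pushʳ-pushˡ E c′ dec ¬coll)
                     (pushʳ-≈ _ _ decreasing 1≤c ¬collides)
  ; validˡ   = decreasing , positive
  ; validʳ   = dec , pos
  ; 1≤c      = 1≤c
  ; 1≤c′     = 1≤c′
  ; length≡  = sym length≡
  ; pushʳ≡   = pushʳ-pushˡ E c′ dec ¬coll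
  ; pushˡ≡   = refl
  }
  where
  ¬coll = ¬collidesˡ E c′ dec red
  open PushˡResult (pushˡ-props E c′ dec pos 1≤c′ ¬coll)

-- Pushing a letter through all rows

Rows : Set
Rows = List (List ℕ)

ValidRows : Rows → Set
ValidRows = All ValidRow

pushʳ-rows : ℕ → Rows → Rows × ℕ
pushʳ-rows c []       = [] , c
pushʳ-rows c (D ∷ Ds) = let E , c₁ = pushʳ c D ; Es , c′ = pushʳ-rows c₁ Ds in E ∷ Es , c′

pushˡ-rows : Rows → ℕ → ℕ × Rows
pushˡ-rows []       c′ = c′ , []
pushˡ-rows (E ∷ Es) c′ = let c₁ , Ds = pushˡ-rows Es c′ ; c , D = pushˡ E c₁ in c , D ∷ Ds

record Exchange (c : ℕ) (Ds Es : Rows) (c′ : ℕ) : Set where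
  field
    exchange : c ∷ concat Ds ≈ concat Es ∷ʳ c′
    validˡ   : ValidRows Ds
    validʳ   : ValidRows Es
    1≤c      : 1 ≤ c
    1≤c′     : 1 ≤ c′
    shape≡   : map length Es ≡ map length Ds
    pushʳ≡   : pushʳ-rows c Ds ≡ (Es , c′)
    pushˡ≡   : pushˡ-rows Es c′ ≡ (c , Ds)

length-concat : ∀ {Ds Es : Rows} → map length Es ≡ map length Ds → length (concat Es) ≡ length (concat Ds)
length-concat {[]}     {[]}     _  = refl
length-concat {D ∷ Ds} {E ∷ Es} eq = begin
  length (E ++ concat Es)          ≡⟨ length-++ E ⟩
  length E + length (concat Es)    ≡⟨ cong₂ _+_ (∷-injectiveˡ eq) (length-concat (∷-injectiveʳ eq)) ⟩
  length D + length (concat Ds)    ≡⟨ length-++ D ⟨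
  length (D ++ concat Ds)          ∎
  where open ≡-Reasoning

length-++ˡ-cong : ∀ (z : List ℕ) {x y : List ℕ} → length x ≡ length y → length (z ++ x) ≡ length (z ++ y)
length-++ˡ-cong z {x} {y} eq = trans (length-++ z) (trans (cong (length z +_) eq) (sym (length-++ z)))

pushʳ-rows-∷ : ∀ {c D Ds E c₁ Es c′} → pushʳ c D ≡ (E , c₁) → pushʳ-rows c₁ Ds ≡ (Es , c′)
             → pushʳ-rows c (D ∷ Ds) ≡ (E ∷ Es , c′)
pushʳ-rows-∷ row rows rewrite row | rows = refl

pushˡ-rows-∷ : ∀ {E Es c′ c₁ Ds c D} → pushˡ-rows Es c′ ≡ (c₁ , Ds) → pushˡ E c₁ ≡ (c , D)
             → pushˡ-rows (E ∷ Es) c′ ≡ (c , D ∷ Ds)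
pushˡ-rows-∷ rows row rewrite rows | row = refl

Exchange-[] : ∀ {c} → 1 ≤ c → Exchange c [] [] c
Exchange-[] 1≤c = record
  { exchange = ≈-refl ; validˡ = [] ; validʳ = [] ; 1≤c = 1≤c ; 1≤c′ = 1≤c
  ; shape≡ = refl ; pushʳ≡ = refl ; pushˡ≡ = refl }

exchange-++ : ∀ {c D E c′} rest → c ∷ D ≈ E ∷ʳ c′ → c ∷ D ++ rest ≈ E ++ c′ ∷ rest
exchange-++ {E = E} {c′} rest ex = ≈-trans (≈-++ʳ rest ex) (≡⇒≈ (++-assoc E (c′ ∷ []) rest))

length-exchange-++ : ∀ {D E : List ℕ} c c′ rest → length E ≡ length D → length (c ∷ D ++ rest) ≡ length (E ++ c′ ∷ rest)
length-exchange-++ {D} {E} c c′ rest |E|≡|D| = begin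
  suc (length (D ++ rest))        ≡⟨ cong suc (length-++ D) ⟩
  suc (length D + length rest)    ≡⟨ cong (λ n → suc (n + length rest)) |E|≡|D| ⟨
  suc (length E + length rest)    ≡⟨ cong suc (length-++ E) ⟨
  suc (length (E ++ rest))        ≡⟨ length-++-sucʳ E c′ rest ⟨
  length (E ++ c′ ∷ rest)         ∎
  where open ≡-Reasoning

exchange-∷ : ∀ {c D E c₁} Ds {Es c′} → c ∷ D ≈ E ∷ʳ c₁ → c₁ ∷ concat Ds ≈ concat Es ∷ʳ c′
           → c ∷ concat (D ∷ Ds) ≈ concat (E ∷ Es) ∷ʳ c′
exchange-∷ {c} {D} {E} {c₁} Ds {Es} {c′} row rows = begin
  c ∷ D ++ concat Ds           ≈⟨ exchange-++ (concat Ds) row ⟩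
  E ++ c₁ ∷ concat Ds          ≈⟨ ≈-++ˡ E rows ⟩
  E ++ (concat Es ∷ʳ c′)       ≡⟨ ++-assoc E (concat Es) (c′ ∷ []) ⟨
  (E ++ concat Es) ∷ʳ c′       ∎
  where open SetoidReasoning ≈-setoid

Exchange-∷ : ∀ {c D E c₁ Ds Es c′} → RowExchange c D E c₁ → Exchange c₁ Ds Es c′ → Exchange c (D ∷ Ds) (E ∷ Es) c′
Exchange-∷ {c} {D} {E} {c₁} {Ds} {Es} {c′} row rows = record
  { exchange = exchange-∷ Ds {Es} (RowExchange.exchange row) (Exchange.exchange rows)
  ; validˡ   = RowExchange.validˡ row ∷ Exchange.validˡ rows
  ; validʳ   = RowExchange.validʳ row ∷ Exchange.validʳ rows
  ; 1≤c      = RowExchange.1≤c row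
  ; 1≤c′     = Exchange.1≤c′ rows
  ; shape≡   = cong₂ _∷_ (RowExchange.length≡ row) (Exchange.shape≡ rows)
  ; pushʳ≡   = pushʳ-rows-∷ {c} {D} {Ds} {E} {c₁} {Es} {c′} (RowExchange.pushʳ≡ row) (Exchange.pushʳ≡ rows)
  ; pushˡ≡   = pushˡ-rows-∷ {E} {Es} {c′} {c₁} {Ds} {c} {D} (Exchange.pushˡ≡ rows) (RowExchange.pushˡ≡ row)
  }

Exchange-length : ∀ {c Ds Es c′} → Exchange c Ds Es c′ → length (c ∷ concat Ds) ≡ length (concat Es ∷ʳ c′)
Exchange-length {Es = Es} X =
  sym (trans (length-++ (concat Es)) (trans (+-comm _ 1) (cong suc (length-concat (Exchange.shape≡ X)))))

pushʳ-rows-exchange : ∀ c Ds → ValidRows Ds → 1 ≤ c → Reduced (c ∷ concat Ds)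
                    → Exchange c Ds (proj₁ (pushʳ-rows c Ds)) (proj₂ (pushʳ-rows c Ds))
pushʳ-rows-exchange c []       []          1≤c _   = Exchange-[] 1≤c
pushʳ-rows-exchange c (D ∷ Ds) (valid ∷ valids) 1≤c red =
  Exchange-∷ row (pushʳ-rows-exchange c₁ Ds valids (RowExchange.1≤c′ row) red₁)
  where
  E : List ℕ
  E = proj₁ (pushʳ c D)
  c₁ : ℕ
  c₁ = proj₂ (pushʳ c D)
  row : RowExchange c D E c₁
  row = pushʳ-exchange valid 1≤c (Reduced-++⁻ˡ (c ∷ D) (concat Ds) red)
  red₁ : Reduced (c₁ ∷ concat Ds)
  red₁ = Reduced-++⁻ʳ E (c₁ ∷ concat Ds)
           (Reduced-≈ (exchange-++ (concat Ds) (RowExchange.exchange row))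
                      (length-exchange-++ {D} {E} c c₁ (concat Ds) (RowExchange.length≡ row)) red)

pushˡ-rows-exchange : ∀ Es c′ → ValidRows Es → 1 ≤ c′ → Reduced (concat Es ∷ʳ c′)
                    → Exchange (proj₁ (pushˡ-rows Es c′)) (proj₂ (pushˡ-rows Es c′)) Es c′
pushˡ-rows-exchange []       c′ []               1≤c′ _   = Exchange-[] 1≤c′
pushˡ-rows-exchange (E ∷ Es) c′ (valid ∷ valids) 1≤c′ red =
  Exchange-∷ (pushˡ-exchange valid (Exchange.1≤c rows) red₁) rows
  where
  red-Es : Reduced (concat Es ∷ʳ c′)
  red-Es = Reduced-++⁻ʳ E (concat Es ∷ʳ c′) (subst Reduced (++-assoc E (concat Es) (c′ ∷ [])) red)
  c₁ : ℕ
  c₁ = proj₁ (pushˡ-rows Es c′)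
  Ds : Rows
  Ds = proj₂ (pushˡ-rows Es c′)
  rows : Exchange c₁ Ds Es c′
  rows = pushˡ-rows-exchange Es c′ valids 1≤c′ red-Es
  red₁ : Reduced (E ∷ʳ c₁)
  red₁ = Reduced-++⁻ˡ (E ∷ʳ c₁) (concat Ds) (subst Reduced (sym (++-assoc E (c₁ ∷ []) (concat Ds)))
           (Reduced-≈ (≈-++ˡ E (≈-sym (Exchange.exchange rows))) (length-++ˡ-cong E (sym (Exchange-length rows)))
             (subst Reduced (++-assoc E (concat Es) (c′ ∷ [])) red)))

column : ℕ → ℕ → ℤ
column i v = ℤ.+ v ℤ.+ (1ℤ ℤ.- ℤ.+ i)

val-column : ∀ i v → val i (column i v) ≡ ℤ.+ v
val-column i v = lemma (ℤ.+ i) (ℤ.+ v)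
  where
  lemma : ∀ (I V : ℤ) → I ℤ.+ (V ℤ.+ (1ℤ ℤ.- I)) ℤ.- 1ℤ ≡ V
  lemma = solve-∀

positive⇒+∣∣≡ : ∀ z → T (1ℤ ℤ.≤ᵇ z) → ℤ.+ ∣ z ∣ ≡ z
positive⇒+∣∣≡ z 1≤z = ℤP.0≤i⇒+∣i∣≡i (ℤP.≤-trans (ℤ.+≤+ z≤n) (ℤP.≤ᵇ⇒≤ 1≤z))

positive⇒1≤∣∣ : ∀ z → T (1ℤ ℤ.≤ᵇ z) → 1 ≤ ∣ z ∣
positive⇒1≤∣∣ z 1≤z = ℤP.drop‿+≤+ (subst (1ℤ ℤ.≤_) (sym (positive⇒+∣∣≡ z 1≤z)) (ℤP.≤ᵇ⇒≤ 1≤z))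

column-val : ∀ i j → T (1ℤ ℤ.≤ᵇ val i j) → column i ∣ val i j ∣ ≡ j
column-val i j 1≤val = trans (cong (ℤ._+ (1ℤ ℤ.- ℤ.+ i)) (positive⇒+∣∣≡ (val i j) 1≤val)) (lemma (ℤ.+ i) j)
  where
  lemma : ∀ (I J : ℤ) → I ℤ.+ J ℤ.- 1ℤ ℤ.+ (1ℤ ℤ.- I) ≡ J
  lemma = solve-∀

1≤val-column : ∀ i v → 1 ≤ v → T (1ℤ ℤ.≤ᵇ val i (column i v))
1≤val-column i v 1≤v = subst (T ∘ (1ℤ ℤ.≤ᵇ_)) (sym (val-column i v)) (ℤP.≤⇒≤ᵇ (ℤ.+≤+ 1≤v))

val-mono-< : ∀ i {x y} → x ℤ.< y → val i x ℤ.< val i y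
val-mono-< i x<y = ℤP.+-monoˡ-< (ℤ.- 1ℤ) (ℤP.+-monoʳ-< (ℤ.+ i) x<y)

column-mono-< : ∀ i {a b} → a < b → column i a ℤ.< column i b
column-mono-< i a<b = ℤP.+-monoˡ-< (1ℤ ℤ.- ℤ.+ i) (ℤ.+<+ a<b)

column-cancel-< : ∀ i {a b} → column i a ℤ.< column i b → a < b
column-cancel-< i {a} {b} lt = ℤP.drop‿+<+ (subst₂ ℤ._<_ (val-column i a) (val-column i b) (val-mono-< i lt))

strictDec⇒Linked : ∀ r → T (strictDec r) → Linked ℤ._>_ r
strictDec⇒Linked []           _ = []
strictDec⇒Linked (x ∷ [])     _ = [-]
strictDec⇒Linked (x ∷ y ∷ ys) t =
  ℤP.suc[i]≤j⇒i<j (ℤP.≤ᵇ⇒≤ (proj₁ y<x×rest)) ∷ strictDec⇒Linked (y ∷ ys) (proj₂ y<x×rest)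
  where y<x×rest = Equivalence.to (T-∧ {ℤ.suc y ℤ.≤ᵇ x}) t

Linked⇒strictDec : ∀ {r} → Linked ℤ._>_ r → T (strictDec r)
Linked⇒strictDec []          = _
Linked⇒strictDec [-]         = _
Linked⇒strictDec (y<x ∷ rest) = Equivalence.from T-∧ (ℤP.≤⇒≤ᵇ (ℤP.i<j⇒suc[i]≤j y<x) , Linked⇒strictDec rest)

rowWord : ℕ → List ℤ → List ℕ
rowWord i = map (∣_∣ ∘ val i)

rowWords : ℕ → List (List ℤ) → Rows
rowWords i []       = []
rowWords i (r ∷ rs) = rowWord i r ∷ rowWords (suc i) rs

fromRowWords : ℕ → Rows → List (List ℤ)
fromRowWords i []       = []
fromRowWords i (D ∷ Ds) = map (column i) D ∷ fromRowWords (suc i) Ds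

wordFrom≡concat : ∀ i P → wordFrom i P ≡ concat (rowWords i P)
wordFrom≡concat i []       = refl
wordFrom≡concat i (r ∷ rs) = cong (rowWord i r ++_) (wordFrom≡concat (suc i) rs)

rowWords-fromRowWords : ∀ i Ds → rowWords i (fromRowWords i Ds) ≡ Ds
rowWords-fromRowWords i []       = refl
rowWords-fromRowWords i (D ∷ Ds) =
  cong₂ _∷_ (trans (sym (map-∘ D)) (map-id-local (All.tabulate λ {v} _ → cong ∣_∣ (val-column i v))))
            (rowWords-fromRowWords (suc i) Ds)

rowCounts-rowWords : ∀ i P → map length (rowWords i P) ≡ rowCounts P
rowCounts-rowWords i []       = refl
rowCounts-rowWords i (r ∷ rs) = cong₂ _∷_ (length-map _ r) (rowCounts-rowWords (suc i) rs)

rowCounts-fromRowWords : ∀ i Ds → rowCounts (fromRowWords i Ds) ≡ map length Ds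
rowCounts-fromRowWords i []       = refl
rowCounts-fromRowWords i (D ∷ Ds) = cong₂ _∷_ (length-map _ D) (rowCounts-fromRowWords (suc i) Ds)

rowOK⇒valid : ∀ i r → T (rowOK i r) → ValidRow (rowWord i r) × map (column i) (rowWord i r) ≡ r
rowOK⇒valid i r ok = (decreasing , positive) , r≡
  where
  strict : T (strictDec r)
  strict = proj₁ (Equivalence.to T-∧ ok)
  vals : All (λ j → T (1ℤ ℤ.≤ᵇ val i j)) r
  vals = all⁺ (λ j → 1ℤ ℤ.≤ᵇ val i j) r (proj₂ (Equivalence.to (T-∧ {strictDec r}) ok))
  r≡ : map (column i) (rowWord i r) ≡ r
  r≡ = trans (sym (map-∘ r)) (map-id-local (All.map (column-val i _) vals))
  decreasing : Decreasing (rowWord i r)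
  decreasing = Linked⇒AllPairs (λ x>y y>z → <-trans y>z x>y) (Linked.map (column-cancel-< i)
                 (Linked.map⁻ (subst (Linked ℤ._>_) (sym r≡) (strictDec⇒Linked r strict))))
  positive : Positive (rowWord i r)
  positive = All.map⁺ (All.map (λ {j} → positive⇒1≤∣∣ (val i j)) vals)

valid⇒rowOK : ∀ i D → ValidRow D → T (rowOK i (map (column i) D))
valid⇒rowOK i D (decreasing , positive) = Equivalence.from T-∧
  ( Linked⇒strictDec (Linked.map⁺ (Linked.map (column-mono-< i) (AllPairs⇒Linked decreasing)))
  , all⁻ _ (All.map⁺ (All.map (λ {v} → 1≤val-column i v) positive)))

rowsOK⇒valid : ∀ i P → T (rowsOK i P) → ValidRows (rowWords i P) × fromRowWords i (rowWords i P) ≡ P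
rowsOK⇒valid i []       _  = [] , refl
rowsOK⇒valid i (r ∷ rs) ok with Equivalence.to (T-∧ {rowOK i r}) ok
... | ok-r , ok-rs with rowOK⇒valid i r ok-r | rowsOK⇒valid (suc i) rs ok-rs
...   | valid , r≡ | valids , rs≡ = valid ∷ valids , cong₂ _∷_ r≡ rs≡

valid⇒rowsOK : ∀ i Ds → ValidRows Ds → T (rowsOK i (fromRowWords i Ds))
valid⇒rowsOK i []       []               = _
valid⇒rowsOK i (D ∷ Ds) (valid ∷ valids) = Equivalence.from T-∧ (valid⇒rowOK i D valid , valid⇒rowsOK (suc i) Ds valids)

==ᴾ⇒≗ : ∀ u v → T (u ==ᴾ v) → fun u ≗ fun v
==ᴾ⇒≗ u v t n with n <? suc (bound u ⊔ bound v)
... | yes n<N = ≡ᵇ⇒≡ _ _ (applyUpTo⁻ id _ (all⁺ (λ m → fun u m ≡ᵇ fun v m) (upTo _) t) n<N)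
... | no  n≮N = trans (fixed u n (≤-<-trans (m≤m⊔n _ _) N≤n)) (sym (fixed v n (≤-<-trans (m≤n⊔m _ _) N≤n)))
  where N≤n = ≤-pred (≰⇒> n≮N)

≗⇒==ᴾ : ∀ u v → fun u ≗ fun v → T (u ==ᴾ v)
≗⇒==ᴾ u v u≗v = all⁻ (λ m → fun u m ≡ᵇ fun v m) (applyUpTo⁺₂ id (suc (bound u ⊔ bound v)) λ n → ≡⇒≡ᵇ _ _ (u≗v n))

-- Reduced stable pipe dreams as factorizations

record Factorization (v : Perm) (α : List ℕ) (Ds : Rows) : Set where
  field
    valid       : ValidRows Ds
    shape       : T (map length Ds ==ᴸ α)
    reducedWord : ReducedWord v (concat Ds)

IsTerm : Perm → List ℕ → List (List ℤ) → Set
IsTerm v α P = T (isSPD α P ∧ isReduced P ∧ (∂ P ==ᴾ v))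

word-fromRowWords : ∀ Ds → word (fromRowWords 1 Ds) ≡ concat Ds
word-fromRowWords Ds = trans (wordFrom≡concat 1 (fromRowWords 1 Ds)) (cong concat (rowWords-fromRowWords 1 Ds))

term⇒factorization : ∀ {v α} P → IsTerm v α P → Factorization v α (rowWords 1 P) × fromRowWords 1 (rowWords 1 P) ≡ P
term⇒factorization {v} {α} P term = record
  { valid       = proj₁ (rowsOK⇒valid 1 P rows-ok)
  ; shape       = subst (λ cs → T (cs ==ᴸ α)) (sym (rowCounts-rowWords 1 P)) shape-ok
  ; reducedWord = subst (ReducedWord v) (wordFrom≡concat 1 P) (red , spells)
  } , proj₂ (rowsOK⇒valid 1 P rows-ok)
  where
  spd : T (isSPD α P)
  spd = proj₁ (Equivalence.to (T-∧ {isSPD α P}) term)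
  reduced∧∂≡v : T (isReduced P) × T (∂ P ==ᴾ v)
  reduced∧∂≡v = Equivalence.to T-∧ (proj₂ (Equivalence.to (T-∧ {isSPD α P}) term))
  rows-ok : T (rowsOK 1 P)
  rows-ok = proj₁ (Equivalence.to (T-∧ {rowsOK 1 P}) spd)
  shape-ok : T (rowCounts P ==ᴸ α)
  shape-ok = proj₂ (Equivalence.to (T-∧ {rowsOK 1 P}) spd)
  red : Reduced (word P)
  red = demazure⇒Reduced (word P) (sym (≡ᵇ⇒≡ _ _ (proj₁ reduced∧∂≡v)))
  spells : fun ⟦ word P ⟧ ≗ fun v
  spells n = trans (sym (proj₁ (Reduced⇒demazure (word P) red) n)) (==ᴾ⇒≗ (∂ P) v (proj₂ reduced∧∂≡v) n)

factorization⇒term : ∀ {v α Ds} → Factorization v α Ds → IsTerm v α (fromRowWords 1 Ds)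
factorization⇒term {v} {α} {Ds} F = Equivalence.from T-∧
  ( Equivalence.from T-∧ (valid⇒rowsOK 1 Ds valid , subst (λ cs → T (cs ==ᴸ α)) (sym (rowCounts-fromRowWords 1 Ds)) shape)
  , Equivalence.from T-∧ (≡⇒≡ᵇ _ _ (sym (proj₂ dem)) , ≗⇒==ᴾ (∂ P) v λ n → trans (proj₁ dem n) (proj₂ word-P n)))
  where
  open Factorization F
  P : List (List ℤ)
  P = fromRowWords 1 Ds
  word-P : ReducedWord v (word P)
  word-P = subst (ReducedWord v) (sym (word-fromRowWords Ds)) reducedWord
  dem : fun (demazure (word P)) ≗ fun ⟦ word P ⟧ × ℓ (demazure (word P)) ≡ length (word P)
  dem = Reduced⇒demazure (word P) (proj₁ word-P)

descentˡ⇒ReducedWord : ∀ {a x} w → ℓ (s a · w) + 1 ≡ ℓ w → ReducedWord (s a · w) x → ReducedWord w (a ∷ x)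
descentˡ⇒ReducedWord {a} {x} w ℓ≡ (red , spells) = red′ , spells′
  where
  spells′ : fun ⟦ a ∷ x ⟧ ≗ fun w
  spells′ n = trans (cong (fun (s a)) (spells n)) (s-involutive a (fun w n))
  red′ : Reduced (a ∷ x)
  red′ = begin
    ℓ ⟦ a ∷ x ⟧     ≡⟨ ℓ-cong ⟦ a ∷ x ⟧ w spells′ ⟩
    ℓ w             ≡⟨ ℓ≡ ⟨
    ℓ (s a · w) + 1 ≡⟨ cong (_+ 1) (ℓ-cong (s a · w) ⟦ x ⟧ (sym ∘ spells)) ⟩
    ℓ ⟦ x ⟧ + 1     ≡⟨ cong (_+ 1) red ⟩
    length x + 1    ≡⟨ +-comm (length x) 1 ⟩
    length (a ∷ x)  ∎
    where open ≡-Reasoning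

ReducedWord⇒descentˡ : ∀ {a x} w → ReducedWord w (a ∷ x) → ℓ (s a · w) + 1 ≡ ℓ w × ReducedWord (s a · w) x
ReducedWord⇒descentˡ {a} {x} w (red , spells) = ℓ≡ , red-x , spells′
  where
  red-x : Reduced x
  red-x = Reduced-++⁻ʳ (a ∷ []) x red
  spells′ : fun ⟦ x ⟧ ≗ fun (s a · w)
  spells′ n = trans (sym (s-involutive a (fun ⟦ x ⟧ n))) (cong (fun (s a)) (spells n))
  ℓ≡ : ℓ (s a · w) + 1 ≡ ℓ w
  ℓ≡ = begin
    ℓ (s a · w) + 1 ≡⟨ cong (_+ 1) (ℓ-cong (s a · w) ⟦ x ⟧ (sym ∘ spells′)) ⟩
    ℓ ⟦ x ⟧ + 1     ≡⟨ cong (_+ 1) red-x ⟩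
    length x + 1    ≡⟨ +-comm (length x) 1 ⟩
    length (a ∷ x)  ≡⟨ red ⟨
    ℓ ⟦ a ∷ x ⟧     ≡⟨ ℓ-cong ⟦ a ∷ x ⟧ w spells ⟩
    ℓ w             ∎
    where open ≡-Reasoning

descentʳ⇒ReducedWord : ∀ {a x} w → ℓ (w · s a) + 1 ≡ ℓ w → ReducedWord (w · s a) x → ReducedWord w (x ∷ʳ a)
descentʳ⇒ReducedWord {a} {x} w ℓ≡ (red , spells) = red′ , spells′
  where
  spells′ : fun ⟦ x ∷ʳ a ⟧ ≗ fun w
  spells′ n = trans (⟦⟧-++ x (a ∷ []) n) (trans (spells _) (cong (fun w) (s-involutive a n)))
  red′ : Reduced (x ∷ʳ a)
  red′ = begin
    ℓ ⟦ x ∷ʳ a ⟧     ≡⟨ ℓ-cong ⟦ x ∷ʳ a ⟧ w spells′ ⟩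
    ℓ w              ≡⟨ ℓ≡ ⟨
    ℓ (w · s a) + 1  ≡⟨ cong (_+ 1) (ℓ-cong (w · s a) ⟦ x ⟧ (sym ∘ spells)) ⟩
    ℓ ⟦ x ⟧ + 1      ≡⟨ cong (_+ 1) red ⟩
    length x + 1     ≡⟨ length-++ x ⟨
    length (x ∷ʳ a)  ∎
    where open ≡-Reasoning

ReducedWord⇒descentʳ : ∀ {a x} w → ReducedWord w (x ∷ʳ a) → ℓ (w · s a) + 1 ≡ ℓ w × ReducedWord (w · s a) x
ReducedWord⇒descentʳ {a} {x} w (red , spells) = ℓ≡ , red-x , spells′
  where
  red-x : Reduced x
  red-x = Reduced-++⁻ˡ x (a ∷ []) red
  spells′ : fun ⟦ x ⟧ ≗ fun (w · s a)
  spells′ n = trans (cong (fun ⟦ x ⟧) (sym (s-involutive a n))) (trans (sym (⟦⟧-++ x (a ∷ []) _)) (spells _))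
  ℓ≡ : ℓ (w · s a) + 1 ≡ ℓ w
  ℓ≡ = begin
    ℓ (w · s a) + 1  ≡⟨ cong (_+ 1) (ℓ-cong (w · s a) ⟦ x ⟧ (sym ∘ spells′)) ⟩
    ℓ ⟦ x ⟧ + 1      ≡⟨ cong (_+ 1) red-x ⟩
    length x + 1     ≡⟨ length-++ x ⟨
    length (x ∷ʳ a)  ≡⟨ red ⟨
    ℓ ⟦ x ∷ʳ a ⟧     ≡⟨ ℓ-cong ⟦ x ∷ʳ a ⟧ w spells ⟩
    ℓ w              ∎
    where open ≡-Reasoning

T-descent⇒ : ∀ k m n → T ((1 ≤ᵇ k) ∧ (m + 1 ≡ᵇ n)) → 1 ≤ k × m + 1 ≡ n
T-descent⇒ k m n t with Equivalence.to (T-∧ {1 ≤ᵇ k}) t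
... | 1≤k , eq = ≤ᵇ⇒≤ 1 k 1≤k , ≡ᵇ⇒≡ _ _ eq

descent⇒T : ∀ k m n → 1 ≤ k → m + 1 ≡ n → T ((1 ≤ᵇ k) ∧ (m + 1 ≡ᵇ n))
descent⇒T k m n 1≤k eq = Equivalence.from T-∧ (≤⇒≤ᵇ 1≤k , ≡⇒≡ᵇ _ _ eq)

-- The bijection

module Rightward (w : Perm) (α : List ℕ) (k : ℕ) (t₁ : T ((1 ≤ᵇ k) ∧ (ℓ (s k · w) + 1 ≡ᵇ ℓ w)))
                 (P : List (List ℤ)) (t₂ : IsTerm (s k · w) α P) where
  Ds : Rows
  Ds = rowWords 1 P

  open Factorization (proj₁ (term⇒factorization {s k · w} {α} P t₂))

  descent : 1 ≤ k × ℓ (s k · w) + 1 ≡ ℓ w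
  descent = T-descent⇒ k (ℓ (s k · w)) (ℓ w) t₁

  Es : Rows
  Es = proj₁ (pushʳ-rows k Ds)

  k′ : ℕ
  k′ = proj₂ (pushʳ-rows k Ds)

  X : Exchange k Ds Es k′
  X = pushʳ-rows-exchange k Ds valid (proj₁ descent) (proj₁ (descentˡ⇒ReducedWord {k} {concat Ds} w (proj₂ descent) reducedWord))

  descent′ : ℓ (w · s k′) + 1 ≡ ℓ w × ReducedWord (w · s k′) (concat Es)
  descent′ = ReducedWord⇒descentʳ {k′} {concat Es} w
    (ReducedWord-≈ {w} (Exchange.exchange X) (Exchange-length X) (descentˡ⇒ReducedWord {k} {concat Ds} w (proj₂ descent) reducedWord))

  F′ : Factorization (w · s k′) α Es
  F′ = record { valid       = Exchange.validʳ X
              ; shape       = subst (λ cs → T (cs ==ᴸ α)) (sym (Exchange.shape≡ X)) shape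
              ; reducedWord = proj₂ descent′ }

  result : RightTerms w α
  result = k′ , descent⇒T k′ (ℓ (w · s k′)) (ℓ w) (Exchange.1≤c′ X) (proj₁ descent′) , fromRowWords 1 Es , factorization⇒term F′

  pulled-back : pushˡ-rows (rowWords 1 (fromRowWords 1 Es)) k′ ≡ (k , Ds)
  pulled-back = trans (cong (λ Es → pushˡ-rows Es k′) (rowWords-fromRowWords 1 Es)) (Exchange.pushˡ≡ X)

module Leftward (w : Perm) (α : List ℕ) (k′ : ℕ) (t₁ : T ((1 ≤ᵇ k′) ∧ (ℓ (w · s k′) + 1 ≡ᵇ ℓ w)))
                (P′ : List (List ℤ)) (t₂ : IsTerm (w · s k′) α P′) where
  Es : Rows
  Es = rowWords 1 P′

  open Factorization (proj₁ (term⇒factorization {w · s k′} {α} P′ t₂))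

  descent : 1 ≤ k′ × ℓ (w · s k′) + 1 ≡ ℓ w
  descent = T-descent⇒ k′ (ℓ (w · s k′)) (ℓ w) t₁

  k : ℕ
  k = proj₁ (pushˡ-rows Es k′)

  Ds : Rows
  Ds = proj₂ (pushˡ-rows Es k′)

  X : Exchange k Ds Es k′
  X = pushˡ-rows-exchange Es k′ valid (proj₁ descent) (proj₁ (descentʳ⇒ReducedWord {k′} {concat Es} w (proj₂ descent) reducedWord))

  descent′ : ℓ (s k · w) + 1 ≡ ℓ w × ReducedWord (s k · w) (concat Ds)
  descent′ = ReducedWord⇒descentˡ {k} {concat Ds} w
    (ReducedWord-≈ {w} (≈-sym (Exchange.exchange X)) (sym (Exchange-length X))
                   (descentʳ⇒ReducedWord {k′} {concat Es} w (proj₂ descent) reducedWord))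

  F′ : Factorization (s k · w) α Ds
  F′ = record { valid       = Exchange.validˡ X
              ; shape       = subst (λ cs → T (cs ==ᴸ α)) (Exchange.shape≡ X) shape
              ; reducedWord = proj₂ descent′ }

  result : LeftTerms w α
  result = k , descent⇒T k (ℓ (s k · w)) (ℓ w) (Exchange.1≤c X) (proj₁ descent′) , fromRowWords 1 Ds , factorization⇒term F′

  pushed-back : pushʳ-rows k (rowWords 1 (fromRowWords 1 Ds)) ≡ (Es , k′)
  pushed-back = trans (cong (pushʳ-rows k) (rowWords-fromRowWords 1 Ds)) (Exchange.pushʳ≡ X)

terms-≡ : ∀ {B : ℕ → Bool} {C : ℕ → List (List ℤ) → Bool} {k k′ t₁ t₁′ P P′ t₂ t₂′} → k ≡ k′ → P ≡ P′
        → _≡_ {A = Σ ℕ λ k → T (B k) × Σ (List (List ℤ)) λ P → T (C k P)} (k , t₁ , P , t₂) (k′ , t₁′ , P′ , t₂′)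
terms-≡ refl refl = cong₂ (λ t₁ t₂ → _ , t₁ , _ , t₂) (T-irrelevant _ _) (T-irrelevant _ _)

corollary7p9 : (w : Perm) (α : List ℕ) → LeftTerms w α ↔ RightTerms w α
corollary7p9 w α = mk↔ₛ′ toRight toLeft right∘left left∘right
  where
  toRight : LeftTerms w α → RightTerms w α
  toRight (k , t₁ , P , t₂) = Rightward.result w α k t₁ P t₂

  toLeft : RightTerms w α → LeftTerms w α
  toLeft (k′ , t₁ , P′ , t₂) = Leftward.result w α k′ t₁ P′ t₂

  left∘right : ∀ x → toLeft (toRight x) ≡ x
  left∘right (k , t₁ , P , t₂) =
    terms-≡ (cong proj₁ pulled-back)
            (trans (cong (fromRowWords 1 ∘ proj₂) pulled-back) (proj₂ (term⇒factorization {s k · w} {α} P t₂)))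
    where open Rightward w α k t₁ P t₂

  right∘left : ∀ x → toRight (toLeft x) ≡ x
  right∘left (k′ , t₁ , P′ , t₂) =
    terms-≡ (cong proj₂ pushed-back)
            (trans (cong (fromRowWords 1 ∘ proj₁) pushed-back) (proj₂ (term⇒factorization {w · s k′} {α} P′ t₂)))
    where open Leftward w α k′ t₁ P′ t₂
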